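{- Let $b\ge1$ and let $\lambda=(\lambda_1\ge\cdots\ge\lambda_b)$ be a partition with $b$ parts, and let $i$ be a positive integer. Then, as formal power series in $q$, \[ G^i_{\lambda}(q)=\sum_{A\subseteq [b]}(-1)^{|A|}q^{\left(\sum_{k=1}^{b-1} f^\lambda_A(k)\right)+if^\lambda_A(b)}\prod_{k=1}^{\max(A)-1} \frac{1}{1-q^{g_A(k)}}\cdot\prod_{k=\max(A)}^{b}\frac{1}{1-q^{g_A(k)+i-1}}. \]
   Context: $[b]=\{1,\dots,b\}$. For partitions $\mu,\lambda$, $\mu\subseteq\lambda$ means $\mu_j\le\lambda_j$ for all $j$ (missing parts being $0$). $G^i_\lambda(q)=\sum_{\mu\subseteq\lambda} q^{i\mu_1+\mu_2+\cdots+\mu_b}$, the sum over all partitions $\mu\subseteq\lambda$ including the empty one (so the first part is given weight $i$). Convention: $\max(\emptyset)=1$. For $A\subseteq[b]$ and $1\le k\le b$: if $A\neq\emptyset$ and $k\ge\min(A)$, then $f^\lambda_A(k)=\lambda_{b+1-\max(A\cap[k])}+1$; otherwise $f^\lambda_A(k)=0$. Also $g_A(k)=k-\max(A\cap[k])+1$. Each $\frac{1}{1-q^m}$ is expanded as $\sum_{j\ge0}q^{mj}$. -}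

module Defs where

open import Data.Nat using (ℕ; zero; suc; _+_; _*_; _∸_; _≤_; _≡ᵇ_; _≤ᵇ_)
open import Data.Integer as ℤ using (ℤ; +_; -_)
open import Data.Bool using (Bool; true; false; if_then_else_; _∧_; _∨_)
open import Data.List as List using (List; []; _∷_; map; concatMap; foldr; upTo)
open import Data.Vec as Vec using (Vec; []; _∷_; toList)
open import Data.Unit using (⊤)
open import Data.Product using (_×_)

-- Formal power series in q with integer coefficients: n ↦ [q^n]

PS : Set
PS = ℕ → ℤ

sumTo : ℕ → (ℕ → ℤ) → ℤ
sumTo zero    f = f 0
sumTo (suc n) f = sumTo n f ℤ.+ f (suc n)

zeroPS : PS
zeroPS _ = + 0

onePS : PS
onePS zero    = + 1
onePS (suc _) = + 0

monomial : ℕ → PS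
monomial e n = if e ≡ᵇ n then + 1 else + 0

_⊕_ : PS → PS → PS
(f ⊕ g) n = f n ℤ.+ g n

_⊛_ : PS → PS → PS
(f ⊛ g) n = sumTo n (λ j → f j ℤ.* g (n ∸ j))

scale : ℤ → PS → PS
scale c f n = c ℤ.* f n

sumPS : List PS → PS
sumPS = foldr _⊕_ zeroPS

prodPS : List PS → PS
prodPS = foldr _⊛_ onePS

countTo : ℕ → (ℕ → Bool) → ℕ
countTo zero    P = if P 0 then 1 else 0
countTo (suc n) P = countTo n P + (if P (suc n) then 1 else 0)

-- 1/(1-q^m) expanded as Σ_{j≥0} q^{mj}: [q^n] = #{ j ≥ 0 | m*j = n }
-- (any such j satisfies j ≤ n when m ≥ 1, which is always the case below)
geom : ℕ → PS
geom m n = + countTo n (λ j → (m * j) ≡ᵇ n)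

-- the list [a, a+1, …, c]  (empty if c < a)
fromTo : ℕ → ℕ → List ℕ
fromTo a c = map (λ j → a + j) (upTo (suc c ∸ a))

prodFromTo : ℕ → ℕ → (ℕ → PS) → PS
prodFromTo a c F = prodPS (map F (fromTo a c))

sumNatFromTo : ℕ → ℕ → (ℕ → ℕ) → ℕ
sumNatFromTo a c F = foldr _+_ 0 (map F (fromTo a c))

Decreasing : ∀ {n} → Vec ℕ n → Set
Decreasing []               = ⊤
Decreasing (x ∷ [])         = ⊤
Decreasing (x ∷ y ∷ xs)     = (y ≤ x) × Decreasing (y ∷ xs)

Positive : ∀ {n} → Vec ℕ n → Set
Positive []       = ⊤
Positive (x ∷ xs) = (1 ≤ x) × Positive xs

decreasingᵇ : ∀ {n} → Vec ℕ n → Bool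
decreasingᵇ []           = true
decreasingᵇ (x ∷ [])     = true
decreasingᵇ (x ∷ y ∷ xs) = (y ≤ᵇ x) ∧ decreasingᵇ (y ∷ xs)

box : ∀ {n} → Vec ℕ n → List (Vec ℕ n)
box []       = [] ∷ []
box (l ∷ ls) = concatMap (λ x → map (x ∷_) (box ls)) (upTo (suc l))

weight : ∀ {n} → ℕ → Vec ℕ n → ℕ
weight i []       = 0
weight i (x ∷ xs) = i * x + Vec.sum xs

-- G^i_λ(q) = Σ_{μ ⊆ λ, μ a partition} q^{i μ₁ + μ₂ + ⋯ + μ_b}
-- (partitions μ ⊆ λ, lam with b parts, are exactly the weakly decreasing
--  vectors μ ∈ ℕ^b with μ_j ≤ λ_j; trailing zeros = missing parts)
G : ∀ {b} → ℕ → Vec ℕ b → PS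
G i lam = sumPS (map (λ μ → if decreasingᵇ μ then monomial (weight i μ) else zeroPS) (box lam))

-- Subsets A ⊆ [b], encoded as Vec Bool b (position k-1 ↔ element k)

allSubsets : (n : ℕ) → List (Vec Bool n)
allSubsets zero    = [] ∷ []
allSubsets (suc n) = concatMap (λ A → (true ∷ A) ∷ (false ∷ A) ∷ []) (allSubsets n)

card : ∀ {n} → Vec Bool n → ℕ
card []           = 0
card (true ∷ A)   = suc (card A)
card (false ∷ A)  = card A

listAtB : List Bool → ℕ → Bool
listAtB []       _       = false
listAtB (x ∷ xs) zero    = x
listAtB (x ∷ xs) (suc k) = listAtB xs k

listAtN : List ℕ → ℕ → ℕ
listAtN []       _       = 0
listAtN (x ∷ xs) zero    = x
listAtN (x ∷ xs) (suc k) = listAtN xs k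

-- k ∈ A  (k is 1-based)
memA : ∀ {n} → Vec Bool n → ℕ → Bool
memA A zero    = false
memA A (suc k) = listAtB (toList A) k

-- λ_j (j is 1-based)
part : ∀ {n} → Vec ℕ n → ℕ → ℕ
part lam zero    = 0
part lam (suc j) = listAtN (toList lam) j

-- max(A ∩ [k]), with max(∅) = 1
maxUpTo : ∀ {n} → Vec Bool n → ℕ → ℕ
maxUpTo A zero    = 1
maxUpTo A (suc k) = if memA A (suc k) then suc k else maxUpTo A k

meetsUpTo : ∀ {n} → Vec Bool n → ℕ → Bool
meetsUpTo A zero    = false
meetsUpTo A (suc k) = memA A (suc k) ∨ meetsUpTo A k

-- max(A), with max(∅) = 1
maxA : ∀ {n} → Vec Bool n → ℕ
maxA {n} A = maxUpTo A n

f : ∀ {b} → Vec ℕ b → Vec Bool b → ℕ → ℕ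
f {b} lam A k = if meetsUpTo A k then part lam (suc b ∸ maxUpTo A k) + 1 else 0

g : ∀ {b} → Vec Bool b → ℕ → ℕ
g A k = k ∸ maxUpTo A k + 1

negOnePow : ℕ → ℤ
negOnePow zero    = + 1
negOnePow (suc m) = - negOnePow m

term : ∀ {b} → ℕ → Vec ℕ b → Vec Bool b → PS
term {b} i lam A =
  scale (negOnePow (card A))
    (monomial (sumNatFromTo 1 (b ∸ 1) (f lam A) + i * f lam A b)
      ⊛ (prodFromTo 1 (maxA A ∸ 1) (λ k → geom (g A k))
      ⊛ prodFromTo (maxA A) b (λ k → geom (g A k + i ∸ 1))))

RHS : ∀ {b} → ℕ → Vec ℕ b → PS
RHS {b} i lam = sumPS (map (term i lam) (allSubsets b))

-- Reverse λ into the increasing list of bounds λ_b ≤ ⋯ ≤ λ₁ and build partitions from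
-- the smallest part upwards.  Without upper bounds, the partitions with b parts all ≥ c
-- have the product generating function q^{c(b-1+i)} Π_{t<b} 1/(1 - q^{t+i}).  Sorting the
-- partitions that violate some bound by the first (smallest) violated bound j gives
--   G = Unbounded − Σ_j G(first j bounds, i = 1) · Unbounded(remaining parts > λ at j).
-- On the right-hand side, sorting the subsets A ⊆ [b] by their largest element, the
-- summand of A = ∅ is the unbounded series, and the summands with largest element j + 1
-- are minus the right-hand side for the last j parts (with i = 1) times the same
-- unbounded factor.  Induction on the number of parts then proves the identity.

module Submission where

open import Defs
open import Data.Nat using (ℕ; zero; suc; _∸_; _≤_; _<_; z≤n; s≤s; _≡ᵇ_; _≤ᵇ_; _≤?_)
  renaming (_+_ to _+ℕ_; _*_ to _*ℕ_)
import Data.Nat.Properties as ℕP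
import Data.Nat.Tactic.RingSolver as ℕSolver
open import Data.Integer using (ℤ; +_; -_) renaming (_+_ to _+ᶻ_; _*_ to _*ᶻ_)
import Data.Integer.Properties as ℤP
import Data.Integer.Tactic.RingSolver as ℤSolver
open import Data.Bool using (Bool; true; false; if_then_else_; T; _∧_; _∨_)
import Data.Bool.Properties as BoolP
open import Data.List using (List; []; _∷_; map; foldr; _++_; upTo; concatMap; length; take; drop; reverse; replicate)
import Data.List.Properties as ListP
open import Data.Nat.ListAction using () renaming (sum to sumL)
import Data.Nat.ListAction.Properties as ListActionP
open import Data.List.Relation.Unary.All using (All; []; _∷_)
import Data.List.Relation.Unary.All as All
import Data.List.Relation.Unary.All.Properties as AllP
open import Data.Vec using (Vec; toList)
import Data.Vec as Vec
import Data.Vec.Properties as VecP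
open import Data.Product using (_×_; _,_)
open import Data.Unit using (⊤; tt)
open import Data.Empty using (⊥-elim)
open import Data.Sum using (inj₁; inj₂)
open import Relation.Nullary using (¬_; yes; no)
open import Relation.Binary.Bundles using (Setoid)
import Relation.Binary.Reasoning.Setoid as SetoidReasoning
open import Relation.Binary.PropositionalEquality

infix 4 _≈_
_≈_ : PS → PS → Set
F ≈ H = ∀ n → F n ≡ H n

≈-refl : ∀ {F} → F ≈ F
≈-refl n = refl

≈-sym : ∀ {F H} → F ≈ H → H ≈ F
≈-sym p n = sym (p n)

≈-trans : ∀ {F H K} → F ≈ H → H ≈ K → F ≈ K
≈-trans p q n = trans (p n) (q n)

≈-reflexive : ∀ {F H} → F ≡ H → F ≈ H
≈-reflexive refl = ≈-refl

PS-setoid : Setoid _ _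
PS-setoid = record
  { Carrier = PS ; _≈_ = _≈_
  ; isEquivalence = record { refl = ≈-refl ; sym = ≈-sym ; trans = ≈-trans } }

module ≈-Reasoning = SetoidReasoning PS-setoid

sumTo-cong : ∀ n {F H : ℕ → ℤ} → (∀ j → j ≤ n → F j ≡ H j) → sumTo n F ≡ sumTo n H
sumTo-cong zero    h = h 0 z≤n
sumTo-cong (suc n) h =
  cong₂ _+ᶻ_ (sumTo-cong n (λ j p → h j (ℕP.m≤n⇒m≤1+n p))) (h (suc n) ℕP.≤-refl)

sumTo-congˢ : ∀ n {F H : ℕ → ℤ} → (∀ j → F j ≡ H j) → sumTo n F ≡ sumTo n H
sumTo-congˢ n h = sumTo-cong n (λ j _ → h j)

+-interchange : ∀ a b c d → (a +ᶻ b) +ᶻ (c +ᶻ d) ≡ (a +ᶻ c) +ᶻ (b +ᶻ d)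
+-interchange = ℤSolver.solve-∀

sumTo-+ : ∀ n (F H : ℕ → ℤ) → sumTo n (λ j → F j +ᶻ H j) ≡ sumTo n F +ᶻ sumTo n H
sumTo-+ zero    F H = refl
sumTo-+ (suc n) F H =
  trans (cong (_+ᶻ (F (suc n) +ᶻ H (suc n))) (sumTo-+ n F H))
        (+-interchange (sumTo n F) (sumTo n H) (F (suc n)) (H (suc n)))

sumTo-*ˡ : ∀ n c (F : ℕ → ℤ) → sumTo n (λ j → c *ᶻ F j) ≡ c *ᶻ sumTo n F
sumTo-*ˡ zero    c F = refl
sumTo-*ˡ (suc n) c F =
  trans (cong (_+ᶻ (c *ᶻ F (suc n))) (sumTo-*ˡ n c F))
        (sym (ℤP.*-distribˡ-+ c (sumTo n F) (F (suc n))))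

sumTo-*ʳ : ∀ n c (F : ℕ → ℤ) → sumTo n (λ j → F j *ᶻ c) ≡ sumTo n F *ᶻ c
sumTo-*ʳ n c F = trans (sumTo-congˢ n (λ j → ℤP.*-comm (F j) c))
                       (trans (sumTo-*ˡ n c F) (ℤP.*-comm c (sumTo n F)))

sumTo-zero : ∀ n → sumTo n (λ _ → + 0) ≡ + 0
sumTo-zero zero    = refl
sumTo-zero (suc n) = cong (_+ᶻ + 0) (sumTo-zero n)

sumTo-head : ∀ n (F : ℕ → ℤ) → sumTo (suc n) F ≡ F 0 +ᶻ sumTo n (λ j → F (suc j))
sumTo-head zero    F = refl
sumTo-head (suc n) F =
  trans (cong (_+ᶻ F (suc (suc n))) (sumTo-head n F))
        (ℤP.+-assoc (F 0) (sumTo n (λ j → F (suc j))) (F (suc (suc n))))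

sumTo-reverse : ∀ n (F : ℕ → ℤ) → sumTo n F ≡ sumTo n (λ j → F (n ∸ j))
sumTo-reverse zero    F = refl
sumTo-reverse (suc n) F = begin
  sumTo (suc n) F                          ≡⟨ sumTo-head n F ⟩
  F 0 +ᶻ sumTo n (λ j → F (suc j))         ≡⟨ cong (F 0 +ᶻ_) (sumTo-reverse n (λ j → F (suc j))) ⟩
  F 0 +ᶻ sumTo n (λ j → F (suc (n ∸ j)))   ≡⟨ ℤP.+-comm (F 0) _ ⟩
  sumTo n (λ j → F (suc (n ∸ j))) +ᶻ F 0
    ≡⟨ cong₂ _+ᶻ_ (sumTo-cong n (λ j p → cong F (sym (ℕP.+-∸-assoc 1 p))))
                  (cong F (sym (ℕP.n∸n≡0 n))) ⟩
  sumTo n (λ j → F (suc n ∸ j)) +ᶻ F (n ∸ n) ∎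
  where open ≡-Reasoning

-- exchanging the order of summation over the triangle k ≤ j ≤ n;
-- gives associativity of the Cauchy product
sumTo-triangle : ∀ n (F : ℕ → ℕ → ℤ) →
  sumTo n (λ j → sumTo j (λ k → F k j)) ≡ sumTo n (λ k → sumTo (n ∸ k) (λ t → F k (k +ℕ t)))
sumTo-triangle zero    F = refl
sumTo-triangle (suc n) F = begin
  sumTo n (λ j → sumTo j (λ k → F k j)) +ᶻ sumTo (suc n) (λ k → F k (suc n))
    ≡⟨ cong (_+ᶻ sumTo (suc n) (λ k → F k (suc n))) (sumTo-triangle n F) ⟩
  Rows n +ᶻ (sumTo n (λ k → F k (suc n)) +ᶻ F (suc n) (suc n))
    ≡⟨ sym (ℤP.+-assoc (Rows n) _ _) ⟩
  (Rows n +ᶻ sumTo n (λ k → F k (suc n))) +ᶻ F (suc n) (suc n)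
    ≡⟨ cong₂ _+ᶻ_ (sym (sumTo-+ n _ _)) (cong (F (suc n)) (sym (ℕP.+-identityʳ (suc n)))) ⟩
  sumTo n (λ k → row n k +ᶻ F k (suc n)) +ᶻ F (suc n) (suc n +ℕ 0)
    ≡⟨ cong₂ _+ᶻ_ (sumTo-cong n extend-row)
                  (cong (λ z → sumTo z (λ t → F (suc n) (suc n +ℕ t))) (sym (ℕP.n∸n≡0 n))) ⟩
  sumTo n (λ k → row (suc n) k) +ᶻ row (suc n) (suc n) ∎
  where
  open ≡-Reasoning
  row : ℕ → ℕ → ℤ
  row m k = sumTo (m ∸ k) (λ t → F k (k +ℕ t))
  Rows : ℕ → ℤ
  Rows m = sumTo m (row m)
  extend-row : ∀ k → k ≤ n → row n k +ᶻ F k (suc n) ≡ row (suc n) k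
  extend-row k p rewrite ℕP.+-∸-assoc 1 p =
    cong (λ z → row n k +ᶻ F k z)
      (sym (trans (ℕP.+-suc k (n ∸ k)) (cong suc (ℕP.m+[n∸m]≡n p))))

⊕-cong : ∀ {A A' B B'} → A ≈ A' → B ≈ B' → A ⊕ B ≈ A' ⊕ B'
⊕-cong p q n = cong₂ _+ᶻ_ (p n) (q n)

⊕-congˡ : ∀ {A A'} B → A ≈ A' → A ⊕ B ≈ A' ⊕ B
⊕-congˡ B p = ⊕-cong p (≈-refl {B})

⊕-congʳ : ∀ A {B B'} → B ≈ B' → A ⊕ B ≈ A ⊕ B'
⊕-congʳ A p = ⊕-cong (≈-refl {A}) p

⊕-comm : ∀ A B → A ⊕ B ≈ B ⊕ A
⊕-comm A B n = ℤP.+-comm (A n) (B n)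

⊕-assoc : ∀ A B C → (A ⊕ B) ⊕ C ≈ A ⊕ (B ⊕ C)
⊕-assoc A B C n = ℤP.+-assoc (A n) (B n) (C n)

⊕-identityˡ : ∀ A → zeroPS ⊕ A ≈ A
⊕-identityˡ A n = ℤP.+-identityˡ (A n)

⊕-identityʳ : ∀ A → A ⊕ zeroPS ≈ A
⊕-identityʳ A n = ℤP.+-identityʳ (A n)

⊕-interchange : ∀ A B C D → (A ⊕ B) ⊕ (C ⊕ D) ≈ (A ⊕ C) ⊕ (B ⊕ D)
⊕-interchange A B C D n = +-interchange (A n) (B n) (C n) (D n)

⊛-cong : ∀ {A A' B B'} → A ≈ A' → B ≈ B' → A ⊛ B ≈ A' ⊛ B'
⊛-cong p q n = sumTo-congˢ n (λ j → cong₂ _*ᶻ_ (p j) (q (n ∸ j)))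

⊛-congˡ : ∀ {A A'} B → A ≈ A' → A ⊛ B ≈ A' ⊛ B
⊛-congˡ B p = ⊛-cong p (≈-refl {B})

⊛-congʳ : ∀ A {B B'} → B ≈ B' → A ⊛ B ≈ A ⊛ B'
⊛-congʳ A p = ⊛-cong (≈-refl {A}) p

⊛-comm : ∀ A B → A ⊛ B ≈ B ⊛ A
⊛-comm A B n = trans (sumTo-reverse n _) (sumTo-cong n λ j p →
  trans (cong (λ z → A (n ∸ j) *ᶻ B z) (ℕP.m∸[m∸n]≡n p)) (ℤP.*-comm (A (n ∸ j)) (B j)))

⊛-assoc : ∀ A B C → (A ⊛ B) ⊛ C ≈ A ⊛ (B ⊛ C)
⊛-assoc A B C n = begin
  sumTo n (λ j → sumTo j (λ k → A k *ᶻ B (j ∸ k)) *ᶻ C (n ∸ j))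
    ≡⟨ sumTo-congˢ n (λ j → sym (sumTo-*ʳ j (C (n ∸ j)) _)) ⟩
  sumTo n (λ j → sumTo j (λ k → A k *ᶻ B (j ∸ k) *ᶻ C (n ∸ j)))
    ≡⟨ sumTo-triangle n (λ k j → A k *ᶻ B (j ∸ k) *ᶻ C (n ∸ j)) ⟩
  sumTo n (λ k → sumTo (n ∸ k) (λ t → A k *ᶻ B (k +ℕ t ∸ k) *ᶻ C (n ∸ (k +ℕ t))))
    ≡⟨ sumTo-congˢ n (λ k → sumTo-congˢ (n ∸ k) (λ t →
         trans (cong₂ (λ u v → A k *ᶻ B u *ᶻ C v) (ℕP.m+n∸m≡n k t) (sym (ℕP.∸-+-assoc n k t)))
               (ℤP.*-assoc (A k) _ _))) ⟩
  sumTo n (λ k → sumTo (n ∸ k) (λ t → A k *ᶻ (B t *ᶻ C (n ∸ k ∸ t))))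
    ≡⟨ sumTo-congˢ n (λ k → sumTo-*ˡ (n ∸ k) (A k) _) ⟩
  sumTo n (λ k → A k *ᶻ sumTo (n ∸ k) (λ t → B t *ᶻ C (n ∸ k ∸ t))) ∎
  where open ≡-Reasoning

⊛-distribˡ : ∀ A B C → A ⊛ (B ⊕ C) ≈ (A ⊛ B) ⊕ (A ⊛ C)
⊛-distribˡ A B C n = trans (sumTo-congˢ n (λ j → ℤP.*-distribˡ-+ (A j) _ _)) (sumTo-+ n _ _)

⊛-distribʳ : ∀ A B C → (B ⊕ C) ⊛ A ≈ (B ⊛ A) ⊕ (C ⊛ A)
⊛-distribʳ A B C = begin
  (B ⊕ C) ⊛ A          ≈⟨ ⊛-comm (B ⊕ C) A ⟩
  A ⊛ (B ⊕ C)          ≈⟨ ⊛-distribˡ A B C ⟩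
  (A ⊛ B) ⊕ (A ⊛ C)    ≈⟨ ⊕-cong (⊛-comm A B) (⊛-comm A C) ⟩
  (B ⊛ A) ⊕ (C ⊛ A)    ∎
  where open ≈-Reasoning

⊛-zeroˡ : ∀ A → zeroPS ⊛ A ≈ zeroPS
⊛-zeroˡ A n = trans (sumTo-congˢ n (λ j → ℤP.*-zeroˡ (A (n ∸ j)))) (sumTo-zero n)

⊛-zeroʳ : ∀ A → A ⊛ zeroPS ≈ zeroPS
⊛-zeroʳ A = ≈-trans (⊛-comm A zeroPS) (⊛-zeroˡ A)

⊛-identityˡ : ∀ A → onePS ⊛ A ≈ A
⊛-identityˡ A zero    = ℤP.*-identityˡ (A 0)
⊛-identityˡ A (suc n) = begin
  (onePS ⊛ A) (suc n)                                          ≡⟨ sumTo-head n _ ⟩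
  + 1 *ᶻ A (suc n) +ᶻ sumTo n (λ j → + 0 *ᶻ A (suc n ∸ suc j))  ≡⟨ cong₂ _+ᶻ_ (ℤP.*-identityˡ (A (suc n))) vanish ⟩
  A (suc n) +ᶻ + 0                                              ≡⟨ ℤP.+-identityʳ (A (suc n)) ⟩
  A (suc n)                                                     ∎
  where
  open ≡-Reasoning
  vanish : sumTo n (λ j → + 0 *ᶻ A (suc n ∸ suc j)) ≡ + 0
  vanish = trans (sumTo-congˢ n (λ j → ℤP.*-zeroˡ (A (suc n ∸ suc j)))) (sumTo-zero n)

⊛-identityʳ : ∀ A → A ⊛ onePS ≈ A
⊛-identityʳ A = ≈-trans (⊛-comm A onePS) (⊛-identityˡ A)

scale-cong : ∀ c {A B} → A ≈ B → scale c A ≈ scale c B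
scale-cong c p n = cong (c *ᶻ_) (p n)

scale-⊛ˡ : ∀ c A B → scale c A ⊛ B ≈ scale c (A ⊛ B)
scale-⊛ˡ c A B n = trans (sumTo-congˢ n (λ j → ℤP.*-assoc c (A j) _)) (sumTo-*ˡ n c _)

scale-⊕ : ∀ c A B → scale c (A ⊕ B) ≈ scale c A ⊕ scale c B
scale-⊕ c A B n = ℤP.*-distribˡ-+ c (A n) (B n)

scale-zero : ∀ c → scale c zeroPS ≈ zeroPS
scale-zero c n = ℤP.*-zeroʳ c

scale-scale : ∀ c d A → scale c (scale d A) ≈ scale (c *ᶻ d) A
scale-scale c d A n = sym (ℤP.*-assoc c d (A n))

scale-one : ∀ A → scale (+ 1) A ≈ A
scale-one A n = ℤP.*-identityˡ (A n)

⊕-solveˡ : ∀ {V B F} → V ≈ B ⊕ F → B ≈ V ⊕ scale (- + 1) F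
⊕-solveˡ {V} {B} {F} p n =
  trans (sym (cancel (B n) (F n))) (cong (λ z → z +ᶻ (- + 1) *ᶻ F n) (sym (p n)))
  where
  cancel : ∀ b v → (b +ᶻ v) +ᶻ (- + 1) *ᶻ v ≡ b
  cancel = ℤSolver.solve-∀

≡ᵇ-true : ∀ {m n} → m ≡ n → (m ≡ᵇ n) ≡ true
≡ᵇ-true {m} {n} p with m ≡ᵇ n | ℕP.≡⇒≡ᵇ m n p
... | true | _ = refl

≡ᵇ-false : ∀ {m n} → ¬ m ≡ n → (m ≡ᵇ n) ≡ false
≡ᵇ-false {m} {n} ne with m ≡ᵇ n in eq
... | false = refl
... | true  = ⊥-elim (ne (ℕP.≡ᵇ⇒≡ m n (subst T (sym eq) tt)))

≤ᵇ-true : ∀ {m n} → m ≤ n → (m ≤ᵇ n) ≡ true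
≤ᵇ-true {m} {n} p with m ≤ᵇ n | ℕP.≤⇒≤ᵇ p
... | true | _ = refl

≤ᵇ-false : ∀ {m n} → n < m → (m ≤ᵇ n) ≡ false
≤ᵇ-false {m} {n} p with m ≤ᵇ n in eq
... | false = refl
... | true  = ⊥-elim (ℕP.<⇒≱ p (ℕP.≤ᵇ⇒≤ m n (subst T (sym eq) tt)))

monomial-self : ∀ e → monomial e e ≡ + 1
monomial-self e rewrite ≡ᵇ-true (refl {x = e}) = refl

monomial-other : ∀ e n → ¬ e ≡ n → monomial e n ≡ + 0
monomial-other e n ne rewrite ≡ᵇ-false ne = refl

monomial-cong : ∀ {a b} → a ≡ b → monomial a ≈ monomial b
monomial-cong refl = ≈-refl

monomial-zero : monomial 0 ≈ onePS
monomial-zero zero    = refl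
monomial-zero (suc n) = refl

sumTo-delta-out : ∀ N e (H : ℕ → ℤ) → N < e → sumTo N (λ j → monomial e j *ᶻ H j) ≡ + 0
sumTo-delta-out zero    e H p =
  trans (cong (_*ᶻ H 0) (monomial-other e 0 (λ q → ℕP.<⇒≢ p (sym q)))) (ℤP.*-zeroˡ (H 0))
sumTo-delta-out (suc N) e H p = cong₂ _+ᶻ_
  (sumTo-delta-out N e H (ℕP.<-trans (ℕP.n<1+n N) p))
  (trans (cong (_*ᶻ H (suc N)) (monomial-other e (suc N) (λ q → ℕP.<⇒≢ p (sym q))))
         (ℤP.*-zeroˡ (H (suc N))))

sumTo-delta-in : ∀ N e (H : ℕ → ℤ) → e ≤ N → sumTo N (λ j → monomial e j *ᶻ H j) ≡ H e
sumTo-delta-in zero    zero H p = trans (cong (_*ᶻ H 0) (monomial-self 0)) (ℤP.*-identityˡ _)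
sumTo-delta-in (suc N) e H p with ℕP.m≤n⇒m<n∨m≡n p
... | inj₁ e<1+N = trans
  (cong₂ _+ᶻ_ (sumTo-delta-in N e H (ℕP.≤-pred e<1+N))
              (trans (cong (_*ᶻ H (suc N)) (monomial-other e (suc N) (ℕP.<⇒≢ e<1+N)))
                     (ℤP.*-zeroˡ (H (suc N)))))
  (ℤP.+-identityʳ (H e))
... | inj₂ refl = trans
  (cong₂ _+ᶻ_ (sumTo-delta-out N (suc N) H ℕP.≤-refl)
              (trans (cong (_*ᶻ H (suc N)) (monomial-self (suc N))) (ℤP.*-identityˡ (H (suc N)))))
  (ℤP.+-identityˡ (H (suc N)))

monomial-⊛-≥ : ∀ e F n → e ≤ n → (monomial e ⊛ F) n ≡ F (n ∸ e)
monomial-⊛-≥ e F n = sumTo-delta-in n e (λ j → F (n ∸ j))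

monomial-⊛-< : ∀ e F n → n < e → (monomial e ⊛ F) n ≡ + 0
monomial-⊛-< e F n = sumTo-delta-out n e (λ j → F (n ∸ j))

≡ᵇ-cancelˡ : ∀ a x y → (a +ℕ x ≡ᵇ a +ℕ y) ≡ (x ≡ᵇ y)
≡ᵇ-cancelˡ zero    x y = refl
≡ᵇ-cancelˡ (suc a) x y = ≡ᵇ-cancelˡ a x y

monomial-+ : ∀ a b → monomial (a +ℕ b) ≈ monomial a ⊛ monomial b
monomial-+ a b n with a ≤? n
... | yes a≤n = begin
  monomial (a +ℕ b) n              ≡⟨ cong (monomial (a +ℕ b)) (sym (ℕP.m+[n∸m]≡n a≤n)) ⟩
  monomial (a +ℕ b) (a +ℕ (n ∸ a)) ≡⟨ cong (λ z → if z then + 1 else + 0) (≡ᵇ-cancelˡ a b (n ∸ a)) ⟩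
  monomial b (n ∸ a)               ≡⟨ sym (monomial-⊛-≥ a (monomial b) n a≤n) ⟩
  (monomial a ⊛ monomial b) n      ∎
  where open ≡-Reasoning
... | no a≰n = trans (monomial-other (a +ℕ b) n (λ q → a≰n (subst (a ≤_) q (ℕP.m≤m+n a b))))
                     (sym (monomial-⊛-< a (monomial b) n (ℕP.≰⇒> a≰n)))

monomial-+-⊛ : ∀ a b P Q → monomial (a +ℕ b) ⊛ (P ⊛ Q) ≈ (monomial a ⊛ P) ⊛ (monomial b ⊛ Q)
monomial-+-⊛ a b P Q = begin
  monomial (a +ℕ b) ⊛ (P ⊛ Q)            ≈⟨ ⊛-congˡ (P ⊛ Q) (monomial-+ a b) ⟩
  (monomial a ⊛ monomial b) ⊛ (P ⊛ Q)    ≈⟨ ⊛-assoc (monomial a) (monomial b) (P ⊛ Q) ⟩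
  monomial a ⊛ (monomial b ⊛ (P ⊛ Q))    ≈⟨ ⊛-congʳ (monomial a) middle ⟩
  monomial a ⊛ (P ⊛ (monomial b ⊛ Q))    ≈⟨ ≈-sym (⊛-assoc (monomial a) P (monomial b ⊛ Q)) ⟩
  (monomial a ⊛ P) ⊛ (monomial b ⊛ Q)    ∎
  where
  open ≈-Reasoning
  middle : monomial b ⊛ (P ⊛ Q) ≈ P ⊛ (monomial b ⊛ Q)
  middle = ≈-trans (≈-sym (⊛-assoc (monomial b) P Q))
             (≈-trans (⊛-congˡ Q (⊛-comm (monomial b) P)) (⊛-assoc P (monomial b) Q))

countTo-cong : ∀ n {P Q : ℕ → Bool} → (∀ j → j ≤ n → P j ≡ Q j) → countTo n P ≡ countTo n Q
countTo-cong zero    h rewrite h 0 z≤n = refl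
countTo-cong (suc n) h rewrite h (suc n) ℕP.≤-refl =
  cong (_+ℕ _) (countTo-cong n (λ j p → h j (ℕP.m≤n⇒m≤1+n p)))

countTo-none : ∀ n {P : ℕ → Bool} → (∀ j → j ≤ n → P j ≡ false) → countTo n P ≡ 0
countTo-none zero    h rewrite h 0 z≤n = refl
countTo-none (suc n) h rewrite h (suc n) ℕP.≤-refl =
  trans (ℕP.+-identityʳ _) (countTo-none n (λ j p → h j (ℕP.m≤n⇒m≤1+n p)))

indicator : Bool → ℕ
indicator b = if b then 1 else 0

countTo-head : ∀ n (P : ℕ → Bool) →
  countTo (suc n) P ≡ indicator (P 0) +ℕ countTo n (λ j → P (suc j))
countTo-head zero    P = refl
countTo-head (suc n) P =
  trans (cong (_+ℕ indicator (P (suc (suc n)))) (countTo-head n P)) (ℕP.+-assoc (indicator (P 0)) _ _)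

countTo-truncate : ∀ N n (P : ℕ → Bool) → n ≤ N → (∀ j → n < j → j ≤ N → P j ≡ false) →
  countTo N P ≡ countTo n P
countTo-truncate N n P p h with ℕP.m≤n⇒m<n∨m≡n p
... | inj₂ refl = refl
countTo-truncate (suc N) n P p h | inj₁ q rewrite h (suc N) q ℕP.≤-refl =
  trans (ℕP.+-identityʳ _) (countTo-truncate N n P (ℕP.≤-pred q) (λ j a b → h j a (ℕP.m≤n⇒m≤1+n b)))

geom-0 : ∀ m → geom m 0 ≡ + 1
geom-0 m rewrite ℕP.*-zeroʳ m = refl

-- no positive multiple of m lies strictly below m
geom-below : ∀ m n → 0 < n → n < m → geom m n ≡ + 0
geom-below m n 0<n n<m = cong +_ (countTo-none n (λ j _ → ≡ᵇ-false (not-multiple j)))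
  where
  not-multiple : ∀ j → ¬ m *ℕ j ≡ n
  not-multiple zero    e = ℕP.<⇒≢ 0<n (trans (sym (ℕP.*-zeroʳ m)) e)
  not-multiple (suc j) e =
    ℕP.<⇒≱ n<m (subst (m ≤_) e (subst (m ≤_) (sym (ℕP.*-suc m j)) (ℕP.m≤m+n m (m *ℕ j))))

geom-shift : ∀ m n → 1 ≤ m → geom m (m +ℕ n) ≡ geom m n
geom-shift m@(suc m') n _ = cong +_ (begin
  countTo (m +ℕ n) P                                      ≡⟨ countTo-head (m' +ℕ n) P ⟩
  indicator (P 0) +ℕ countTo (m' +ℕ n) (λ j → P (suc j))  ≡⟨ cong₂ _+ℕ_ (cong indicator P0) shifted ⟩
  countTo (m' +ℕ n) Q                                     ≡⟨ countTo-truncate (m' +ℕ n) n Q (ℕP.m≤n+m n m') beyond ⟩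
  countTo n Q                                             ∎)
  where
  open ≡-Reasoning
  P Q : ℕ → Bool
  P j = (m *ℕ j) ≡ᵇ (m +ℕ n)
  Q j = (m *ℕ j) ≡ᵇ n
  P0 : P 0 ≡ false
  P0 rewrite ℕP.*-zeroʳ m = refl
  shifted : countTo (m' +ℕ n) (λ j → P (suc j)) ≡ countTo (m' +ℕ n) Q
  shifted = countTo-cong (m' +ℕ n) (λ j _ →
    trans (cong (_≡ᵇ (m +ℕ n)) (ℕP.*-suc m j)) (≡ᵇ-cancelˡ m (m *ℕ j) n))
  beyond : ∀ j → n < j → j ≤ m' +ℕ n → Q j ≡ false
  beyond j n<j _ = ≡ᵇ-false (λ e → ℕP.<⇒≢ (ℕP.<-≤-trans n<j (ℕP.m≤n*m j m)) (sym e))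

geom-unfold : ∀ m → 1 ≤ m → geom m ≈ onePS ⊕ (monomial m ⊛ geom m)
geom-unfold m 1≤m n with m ≤? n
... | yes m≤n = begin
  geom m n                                ≡⟨ cong (geom m) (sym (ℕP.m+[n∸m]≡n m≤n)) ⟩
  geom m (m +ℕ (n ∸ m))                   ≡⟨ geom-shift m (n ∸ m) 1≤m ⟩
  geom m (n ∸ m)                          ≡⟨ sym (ℤP.+-identityˡ _) ⟩
  + 0 +ᶻ geom m (n ∸ m)                   ≡⟨ cong₂ _+ᶻ_ (sym (onePS-pos (ℕP.<-≤-trans 1≤m m≤n)))
                                                        (sym (monomial-⊛-≥ m (geom m) n m≤n)) ⟩
  onePS n +ᶻ (monomial m ⊛ geom m) n      ∎
  where
  open ≡-Reasoning
  onePS-pos : ∀ {n} → 0 < n → onePS n ≡ + 0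
  onePS-pos {suc _} _ = refl
geom-unfold m 1≤m zero | no _ =
  trans (geom-0 m) (sym (cong (+ 1 +ᶻ_) (monomial-⊛-< m (geom m) 0 1≤m)))
geom-unfold m 1≤m (suc n) | no m≰n =
  trans (geom-below m (suc n) (s≤s z≤n) (ℕP.≰⇒> m≰n))
        (sym (trans (ℤP.+-identityˡ _) (monomial-⊛-< m (geom m) (suc n) (ℕP.≰⇒> m≰n))))

Σ< : ℕ → (ℕ → PS) → PS
Σ< zero    F = zeroPS
Σ< (suc n) F = Σ< n F ⊕ F n

ΣL : {A : Set} → List A → (A → PS) → PS
ΣL xs F = sumPS (map F xs)

Σ<-cong : ∀ n {F H : ℕ → PS} → (∀ x → x < n → F x ≈ H x) → Σ< n F ≈ Σ< n H
Σ<-cong zero    h = ≈-refl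
Σ<-cong (suc n) h = ⊕-cong (Σ<-cong n (λ x p → h x (ℕP.m<n⇒m<1+n p))) (h n ℕP.≤-refl)

Σ<-congˢ : ∀ n {F H : ℕ → PS} → (∀ x → F x ≈ H x) → Σ< n F ≈ Σ< n H
Σ<-congˢ n h = Σ<-cong n (λ x _ → h x)

Σ<-zero : ∀ n → Σ< n (λ _ → zeroPS) ≈ zeroPS
Σ<-zero zero    = ≈-refl
Σ<-zero (suc n) = ≈-trans (⊕-identityʳ (Σ< n (λ _ → zeroPS))) (Σ<-zero n)

Σ<-⊕ : ∀ n (F H : ℕ → PS) → Σ< n (λ x → F x ⊕ H x) ≈ Σ< n F ⊕ Σ< n H
Σ<-⊕ zero    F H = ≈-sym (⊕-identityʳ zeroPS)
Σ<-⊕ (suc n) F H =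
  ≈-trans (⊕-congˡ (F n ⊕ H n) (Σ<-⊕ n F H)) (⊕-interchange (Σ< n F) (Σ< n H) (F n) (H n))

Σ<-⊛ʳ : ∀ n (F : ℕ → PS) K → Σ< n (λ x → F x ⊛ K) ≈ Σ< n F ⊛ K
Σ<-⊛ʳ zero    F K = ≈-sym (⊛-zeroˡ K)
Σ<-⊛ʳ (suc n) F K =
  ≈-trans (⊕-congˡ (F n ⊛ K) (Σ<-⊛ʳ n F K)) (≈-sym (⊛-distribʳ K (Σ< n F) (F n)))

Σ<-⊛ˡ : ∀ n (F : ℕ → PS) K → Σ< n (λ x → K ⊛ F x) ≈ K ⊛ Σ< n F
Σ<-⊛ˡ n F K = ≈-trans (Σ<-congˢ n (λ x → ⊛-comm K (F x)))
                (≈-trans (Σ<-⊛ʳ n F K) (⊛-comm (Σ< n F) K))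

Σ<-scale : ∀ n c (F : ℕ → PS) → Σ< n (λ x → scale c (F x)) ≈ scale c (Σ< n F)
Σ<-scale zero    c F = ≈-sym (scale-zero c)
Σ<-scale (suc n) c F =
  ≈-trans (⊕-congˡ (scale c (F n)) (Σ<-scale n c F)) (≈-sym (scale-⊕ c (Σ< n F) (F n)))

Σ<-head : ∀ n (F : ℕ → PS) → Σ< (suc n) F ≈ F 0 ⊕ Σ< n (λ x → F (suc x))
Σ<-head zero    F = ≈-trans (⊕-identityˡ (F 0)) (≈-sym (⊕-identityʳ (F 0)))
Σ<-head (suc n) F =
  ≈-trans (⊕-congˡ (F (suc n)) (Σ<-head n F)) (⊕-assoc (F 0) (Σ< n (λ x → F (suc x))) (F (suc n)))

Σ<-swap : ∀ n k (F : ℕ → ℕ → PS) → Σ< n (λ x → Σ< k (F x)) ≈ Σ< k (λ y → Σ< n (λ x → F x y))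
Σ<-swap zero    k F = ≈-sym (Σ<-zero k)
Σ<-swap (suc n) k F =
  ≈-trans (⊕-congˡ (Σ< k (F n)) (Σ<-swap n k F)) (≈-sym (Σ<-⊕ k (λ y → Σ< n (λ x → F x y)) (F n)))

ΣL-cong : {A : Set} (xs : List A) {F H : A → PS} → (∀ x → F x ≈ H x) → ΣL xs F ≈ ΣL xs H
ΣL-cong []       h = ≈-refl
ΣL-cong (x ∷ xs) h = ⊕-cong (h x) (ΣL-cong xs h)

ΣL-zero : {A : Set} (xs : List A) → ΣL xs (λ _ → zeroPS) ≈ zeroPS
ΣL-zero []       = ≈-refl
ΣL-zero (x ∷ xs) = ≈-trans (⊕-identityˡ (ΣL xs (λ _ → zeroPS))) (ΣL-zero xs)

ΣL-++ : {A : Set} (xs ys : List A) (F : A → PS) → ΣL (xs ++ ys) F ≈ ΣL xs F ⊕ ΣL ys F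
ΣL-++ []       ys F = ≈-sym (⊕-identityˡ (ΣL ys F))
ΣL-++ (x ∷ xs) ys F =
  ≈-trans (⊕-congʳ (F x) (ΣL-++ xs ys F)) (≈-sym (⊕-assoc (F x) (ΣL xs F) (ΣL ys F)))

ΣL-map : {A B : Set} (xs : List A) (h : A → B) (F : B → PS) → ΣL (map h xs) F ≈ ΣL xs (λ x → F (h x))
ΣL-map []       h F = ≈-refl
ΣL-map (x ∷ xs) h F = ⊕-congʳ (F (h x)) (ΣL-map xs h F)

ΣL-concatMap : {A B : Set} (xs : List A) (h : A → List B) (F : B → PS) →
  ΣL (concatMap h xs) F ≈ ΣL xs (λ x → ΣL (h x) F)
ΣL-concatMap []       h F = ≈-refl
ΣL-concatMap (x ∷ xs) h F =
  ≈-trans (ΣL-++ (h x) (concatMap h xs) F) (⊕-congʳ (ΣL (h x) F) (ΣL-concatMap xs h F))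

ΣL-⊕ : {A : Set} (xs : List A) (F H : A → PS) → ΣL xs (λ x → F x ⊕ H x) ≈ ΣL xs F ⊕ ΣL xs H
ΣL-⊕ []       F H = ≈-sym (⊕-identityʳ zeroPS)
ΣL-⊕ (x ∷ xs) F H =
  ≈-trans (⊕-congʳ (F x ⊕ H x) (ΣL-⊕ xs F H)) (⊕-interchange (F x) (H x) (ΣL xs F) (ΣL xs H))

ΣL-⊛ʳ : {A : Set} (xs : List A) (F : A → PS) (K : PS) → ΣL xs (λ x → F x ⊛ K) ≈ ΣL xs F ⊛ K
ΣL-⊛ʳ []       F K = ≈-sym (⊛-zeroˡ K)
ΣL-⊛ʳ (x ∷ xs) F K =
  ≈-trans (⊕-congʳ (F x ⊛ K) (ΣL-⊛ʳ xs F K)) (≈-sym (⊛-distribʳ K (F x) (ΣL xs F)))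

ΣL-scale : {A : Set} (xs : List A) (c : ℤ) (F : A → PS) → ΣL xs (λ x → scale c (F x)) ≈ scale c (ΣL xs F)
ΣL-scale []       c F = ≈-sym (scale-zero c)
ΣL-scale (x ∷ xs) c F =
  ≈-trans (⊕-congʳ (scale c (F x)) (ΣL-scale xs c F)) (≈-sym (scale-⊕ c (F x) (ΣL xs F)))

ΣL-swap : {A B : Set} (xs : List A) (ys : List B) (F : A → B → PS) →
  ΣL xs (λ x → ΣL ys (F x)) ≈ ΣL ys (λ y → ΣL xs (λ x → F x y))
ΣL-swap []       ys F = ≈-sym (ΣL-zero ys)
ΣL-swap (x ∷ xs) ys F =
  ≈-trans (⊕-congʳ (ΣL ys (F x)) (ΣL-swap xs ys F))
          (≈-sym (ΣL-⊕ ys (F x) (λ y → ΣL xs (λ x' → F x' y))))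

ΣL-upTo : ∀ n (F : ℕ → PS) → ΣL (upTo n) F ≈ Σ< n F
ΣL-upTo zero    F = ≈-refl
ΣL-upTo (suc n) F = begin
  ΣL (upTo (suc n)) F            ≈⟨ ≈-reflexive (cong (λ xs → ΣL xs F) (sym (ListP.upTo-∷ʳ n))) ⟩
  ΣL (upTo n ++ n ∷ []) F        ≈⟨ ΣL-++ (upTo n) (n ∷ []) F ⟩
  ΣL (upTo n) F ⊕ (F n ⊕ zeroPS) ≈⟨ ⊕-cong (ΣL-upTo n F) (⊕-identityʳ (F n)) ⟩
  Σ< (suc n) F                   ∎
  where open ≈-Reasoning

guard : Bool → PS → PS
guard b F = if b then F else zeroPS

guard-cong : ∀ b {F H} → F ≈ H → guard b F ≈ guard b H
guard-cong true  p = p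
guard-cong false p = ≈-refl

guard-⊕ : ∀ b F H → guard b (F ⊕ H) ≈ guard b F ⊕ guard b H
guard-⊕ true  F H = ≈-refl
guard-⊕ false F H = ≈-sym (⊕-identityˡ zeroPS)

guard-⊛ʳ : ∀ b F K → guard b F ⊛ K ≈ guard b (F ⊛ K)
guard-⊛ʳ true  F K = ≈-refl
guard-⊛ʳ false F K = ⊛-zeroˡ K

guard-Σ< : ∀ b n F → guard b (Σ< n F) ≈ Σ< n (λ x → guard b (F x))
guard-Σ< true  n F = ≈-refl
guard-Σ< false n F = ≈-sym (Σ<-zero n)

guard-ΣL : ∀ b {A : Set} (xs : List A) (F : A → PS) → ΣL xs (λ x → guard b (F x)) ≈ guard b (ΣL xs F)
guard-ΣL true  xs F = ≈-refl
guard-ΣL false xs F = ΣL-zero xs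

guard-zero : ∀ b → guard b zeroPS ≈ zeroPS
guard-zero true  = ≈-refl
guard-zero false = ≈-refl

Σ<-guard-none : ∀ k c (F : ℕ → PS) → k ≤ c → Σ< k (λ x → guard (c ≤ᵇ x) (F x)) ≈ zeroPS
Σ<-guard-none k c F k≤c = ≈-trans
  (Σ<-cong k (λ x x<k → ≈-reflexive (cong (λ b → guard b (F x)) (≤ᵇ-false (ℕP.<-≤-trans x<k k≤c)))))
  (Σ<-zero k)

geom-peel : ∀ M → 1 ≤ M → ∀ k →
  monomial (k *ℕ M) ⊛ geom M ≈ monomial (k *ℕ M) ⊕ (monomial (suc k *ℕ M) ⊛ geom M)
geom-peel M 1≤M k = begin
  qk ⊛ geom M                                   ≈⟨ ⊛-congʳ qk (geom-unfold M 1≤M) ⟩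
  qk ⊛ (onePS ⊕ (monomial M ⊛ geom M))          ≈⟨ ⊛-distribˡ qk onePS (monomial M ⊛ geom M) ⟩
  (qk ⊛ onePS) ⊕ (qk ⊛ (monomial M ⊛ geom M))   ≈⟨ ⊕-cong (⊛-identityʳ qk) (≈-sym (⊛-assoc qk (monomial M) (geom M))) ⟩
  qk ⊕ ((qk ⊛ monomial M) ⊛ geom M)             ≈⟨ ⊕-congʳ qk (⊛-congˡ (geom M) shift) ⟩
  qk ⊕ (monomial (suc k *ℕ M) ⊛ geom M)         ∎
  where
  open ≈-Reasoning
  qk = monomial (k *ℕ M)
  shift : qk ⊛ monomial M ≈ monomial (suc k *ℕ M)
  shift = ≈-trans (⊛-comm qk (monomial M)) (≈-sym (monomial-+ M (k *ℕ M)))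

geom-telescope : ∀ M → 1 ≤ M → ∀ k c → c ≤ k →
  monomial (c *ℕ M) ⊛ geom M ≈
    Σ< k (λ x → guard (c ≤ᵇ x) (monomial (x *ℕ M))) ⊕ (monomial (k *ℕ M) ⊛ geom M)
geom-telescope M 1≤M zero .zero z≤n = ≈-sym (⊕-identityˡ _)
geom-telescope M 1≤M (suc k) c c≤1+k with ℕP.m≤n⇒m<n∨m≡n c≤1+k
... | inj₂ refl = ≈-sym (≈-trans
  (⊕-congˡ (monomial (suc k *ℕ M) ⊛ geom M) (Σ<-guard-none (suc k) (suc k) _ ℕP.≤-refl))
  (⊕-identityˡ _))
... | inj₁ c≤k = begin
  monomial (c *ℕ M) ⊛ geom M                          ≈⟨ geom-telescope M 1≤M k c (ℕP.≤-pred c≤k) ⟩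
  S ⊕ (monomial (k *ℕ M) ⊛ geom M)                    ≈⟨ ⊕-congʳ S (geom-peel M 1≤M k) ⟩
  S ⊕ (monomial (k *ℕ M) ⊕ R)                         ≈⟨ ≈-sym (⊕-assoc S (monomial (k *ℕ M)) R) ⟩
  (S ⊕ monomial (k *ℕ M)) ⊕ R                         ≈⟨ ⊕-congˡ R (⊕-congʳ S guarded) ⟩
  (S ⊕ guard (c ≤ᵇ k) (monomial (k *ℕ M))) ⊕ R        ∎
  where
  open ≈-Reasoning
  S = Σ< k (λ x → guard (c ≤ᵇ x) (monomial (x *ℕ M)))
  R = monomial (suc k *ℕ M) ⊛ geom M
  guarded : monomial (k *ℕ M) ≈ guard (c ≤ᵇ k) (monomial (k *ℕ M))
  guarded = ≈-reflexive (cong (λ b → guard b (monomial (k *ℕ M))) (sym (≤ᵇ-true (ℕP.≤-pred c≤k))))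

-- Generating functions of partitions, built from the smallest part upwards.
-- A list L = (λ_b ≤ ⋯ ≤ λ_1) of increasing upper bounds is consumed from the front;
-- the part x chosen for the last bound is μ₁ and carries weight i, all others weight 1.

partCoeff : ℕ → List ℕ → ℕ
partCoeff i []      = i
partCoeff i (_ ∷ _) = 1

-- Σ q^{i μ₁ + μ₂ + ⋯} over weakly decreasing μ with μ_k ≤ λ_k and smallest part ≥ c
Bounded : ℕ → List ℕ → ℕ → PS
Bounded i []      c = onePS
Bounded i (l ∷ L) c = Σ< (suc l) (λ x → guard (c ≤ᵇ x) (monomial (partCoeff i L *ℕ x) ⊛ Bounded i L x))

-- the weight (n - 1) + i of the partition (1, …, 1) with n parts
unitWeight : ℕ → ℕ → ℕ
unitWeight i zero    = 0
unitWeight i (suc n) = n +ℕ i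

geomProd : ℕ → ℕ → PS
geomProd i zero    = onePS
geomProd i (suc n) = geom (n +ℕ i) ⊛ geomProd i n

-- Σ q^{i μ₁ + μ₂ + ⋯} over all partitions with n parts, all ≥ c:
--   q^{c((n-1)+i)} Π_{t<n} 1/(1 - q^{t+i})
Unbounded : ℕ → ℕ → ℕ → PS
Unbounded i n c = monomial (c *ℕ unitWeight i n) ⊛ geomProd i n

-- the partitions counted by Unbounded but not by Bounded, classified by the
-- first (smallest) part violating its bound
Violating : ℕ → List ℕ → ℕ → PS
Violating i []      c = zeroPS
Violating i (l ∷ L) c =
  Unbounded i (suc (length L)) (suc l)
    ⊕ Σ< (suc l) (λ x → guard (c ≤ᵇ x) (monomial (partCoeff i L *ℕ x) ⊛ Violating i L x))

Increasing : List ℕ → Set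
Increasing []      = ⊤
Increasing (l ∷ L) = All (l ≤_) L × Increasing L

LowerFits : ℕ → List ℕ → Set
LowerFits c []      = ⊤
LowerFits c (l ∷ _) = c ≤ suc l

partCoeff-unitWeight : ∀ i L → partCoeff i L +ℕ unitWeight i (length L) ≡ length L +ℕ i
partCoeff-unitWeight i []      = ℕP.+-identityʳ i
partCoeff-unitWeight i (_ ∷ _) = refl

monomial-merge : ∀ w S x W → monomial (w *ℕ x) ⊛ (monomial (x *ℕ S) ⊛ W) ≈ monomial (x *ℕ (w +ℕ S)) ⊛ W
monomial-merge w S x W = ≈-trans (≈-sym (⊛-assoc (monomial (w *ℕ x)) (monomial (x *ℕ S)) W))
  (⊛-congˡ W (≈-trans (≈-sym (monomial-+ (w *ℕ x) (x *ℕ S))) (monomial-cong (exponent w S x))))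
  where
  exponent : ∀ w S x → w *ℕ x +ℕ x *ℕ S ≡ x *ℕ (w +ℕ S)
  exponent = ℕSolver.solve-∀

-- choosing the smallest part x of an unbounded partition: the parts x ∈ [c, l] are
-- listed explicitly, and those > l are collected in Unbounded with lower bound l + 1
unbounded-telescope : ∀ i → 1 ≤ i → ∀ L l c → c ≤ suc l →
  Unbounded i (suc (length L)) c ≈
    Σ< (suc l) (λ x → guard (c ≤ᵇ x) (monomial (partCoeff i L *ℕ x) ⊛ Unbounded i (length L) x))
      ⊕ Unbounded i (suc (length L)) (suc l)
unbounded-telescope i 1≤i L l c c≤1+l = begin
  monomial (c *ℕ M) ⊛ (geom M ⊛ W)                ≈⟨ ≈-sym (⊛-assoc (monomial (c *ℕ M)) (geom M) W) ⟩
  (monomial (c *ℕ M) ⊛ geom M) ⊛ W                ≈⟨ ⊛-congˡ W (geom-telescope M 1≤M (suc l) c c≤1+l) ⟩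
  (S ⊕ (monomial (suc l *ℕ M) ⊛ geom M)) ⊛ W      ≈⟨ ⊛-distribʳ W S (monomial (suc l *ℕ M) ⊛ geom M) ⟩
  (S ⊛ W) ⊕ ((monomial (suc l *ℕ M) ⊛ geom M) ⊛ W) ≈⟨ ⊕-cong (≈-sym (Σ<-⊛ʳ (suc l) _ W))
                                                              (⊛-assoc (monomial (suc l *ℕ M)) (geom M) W) ⟩
  Σ< (suc l) (λ x → guard (c ≤ᵇ x) (monomial (x *ℕ M)) ⊛ W) ⊕ Unbounded i (suc n) (suc l)
    ≈⟨ ⊕-congˡ (Unbounded i (suc n) (suc l)) (Σ<-congˢ (suc l) (λ x →
         ≈-trans (guard-⊛ʳ (c ≤ᵇ x) (monomial (x *ℕ M)) W) (guard-cong (c ≤ᵇ x) (≈-sym (smallest-part x))))) ⟩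
  Σ< (suc l) (λ x → guard (c ≤ᵇ x) (monomial (partCoeff i L *ℕ x) ⊛ Unbounded i n x))
    ⊕ Unbounded i (suc n) (suc l) ∎
  where
  open ≈-Reasoning
  n = length L
  M = n +ℕ i
  W = geomProd i n
  1≤M : 1 ≤ M
  1≤M = ℕP.≤-trans 1≤i (ℕP.m≤n+m i n)
  S = Σ< (suc l) (λ x → guard (c ≤ᵇ x) (monomial (x *ℕ M)))
  smallest-part : ∀ x → monomial (partCoeff i L *ℕ x) ⊛ Unbounded i n x ≈ monomial (x *ℕ M) ⊛ W
  smallest-part x = ≈-trans (monomial-merge (partCoeff i L) (unitWeight i n) x W)
                      (⊛-congˡ W (monomial-cong (cong (x *ℕ_) (partCoeff-unitWeight i L))))

-- every partition ≥ c either respects all bounds or has a first violation: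
--   Unbounded = Bounded + Violating
unbounded-split : ∀ i → 1 ≤ i → ∀ L c → Increasing L → LowerFits c L →
  Unbounded i (length L) c ≈ Bounded i L c ⊕ Violating i L c
unbounded-split i 1≤i [] c _ _ = begin
  monomial (c *ℕ 0) ⊛ onePS ≈⟨ ⊛-identityʳ _ ⟩
  monomial (c *ℕ 0)         ≈⟨ ≈-trans (monomial-cong (ℕP.*-zeroʳ c)) monomial-zero ⟩
  onePS                     ≈⟨ ≈-sym (⊕-identityʳ onePS) ⟩
  onePS ⊕ zeroPS            ∎
  where open ≈-Reasoning
unbounded-split i 1≤i (l ∷ L) c (l≤L , incL) c≤1+l = begin
  Unbounded i (suc (length L)) c
    ≈⟨ unbounded-telescope i 1≤i L l c c≤1+l ⟩
  Σ< (suc l) (λ x → guard (c ≤ᵇ x) (q x ⊛ Unbounded i (length L) x)) ⊕ U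
    ≈⟨ ⊕-congˡ U (Σ<-cong (suc l) (λ x x≤l → guard-cong (c ≤ᵇ x) (split-above x (ℕP.≤-pred x≤l)))) ⟩
  Σ< (suc l) (λ x → guard (c ≤ᵇ x) ((q x ⊛ Bounded i L x) ⊕ (q x ⊛ Violating i L x))) ⊕ U
    ≈⟨ ⊕-congˡ U (≈-trans (Σ<-congˢ (suc l) (λ x → guard-⊕ (c ≤ᵇ x) _ _)) (Σ<-⊕ (suc l) _ _)) ⟩
  (SB ⊕ SV) ⊕ U
    ≈⟨ ≈-trans (⊕-assoc SB SV U) (⊕-congʳ SB (⊕-comm SV U)) ⟩
  SB ⊕ (U ⊕ SV) ∎
  where
  open ≈-Reasoning
  q : ℕ → PS
  q x = monomial (partCoeff i L *ℕ x)
  U = Unbounded i (suc (length L)) (suc l)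
  SB = Σ< (suc l) (λ x → guard (c ≤ᵇ x) (q x ⊛ Bounded i L x))
  SV = Σ< (suc l) (λ x → guard (c ≤ᵇ x) (q x ⊛ Violating i L x))
  fits : ∀ x → x ≤ l → All (l ≤_) L → LowerFits x L
  fits x x≤l []          = tt
  fits x x≤l (l≤l' ∷ _)  = ℕP.m≤n⇒m≤1+n (ℕP.≤-trans x≤l l≤l')
  split-above : ∀ x → x ≤ l → q x ⊛ Unbounded i (length L) x ≈ (q x ⊛ Bounded i L x) ⊕ (q x ⊛ Violating i L x)
  split-above x x≤l = ≈-trans (⊛-congʳ (q x) (unbounded-split i 1≤i L x incL (fits x x≤l l≤L)))
                              (⊛-distribˡ (q x) (Bounded i L x) (Violating i L x))

-- Closed form of Violating, by the position j of the first violated bound: the parts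
-- before it form a bounded partition (all of weight 1, since larger parts follow), and
-- the parts from j on form an unbounded partition with all parts > λ at position j.
ViolatingAt : ℕ → List ℕ → ℕ → PS
ViolatingAt i L c =
  Σ< (length L) (λ j → Bounded 1 (take j L) c ⊛ Unbounded i (length L ∸ j) (suc (listAtN L j)))

violating-closed : ∀ i L c → Violating i L c ≈ ViolatingAt i L c

-- the recursive part of Violating i (l ∷ L), i.e. the violations after the first part
violating-later : ∀ i l L c →
  Σ< (suc l) (λ x → guard (c ≤ᵇ x) (monomial (partCoeff i L *ℕ x) ⊛ Violating i L x))
    ≈ Σ< (length L) (λ j → Bounded 1 (l ∷ take j L) c ⊛ Unbounded i (length L ∸ j) (suc (listAtN L j)))

violating-closed i []      c = ≈-refl
violating-closed i (l ∷ L) c = ≈-trans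
  (⊕-cong (≈-sym (⊛-identityˡ (Unbounded i (suc (length L)) (suc l)))) (violating-later i l L c))
  (≈-sym (Σ<-head (length L) (λ j →
     Bounded 1 (take j (l ∷ L)) c ⊛ Unbounded i (suc (length L) ∸ j) (suc (listAtN (l ∷ L) j)))))

violating-later i l []          c = ≈-trans
  (Σ<-congˢ (suc l) (λ x → ≈-trans (guard-cong (c ≤ᵇ x) (⊛-zeroʳ (monomial (i *ℕ x)))) (guard-zero (c ≤ᵇ x))))
  (Σ<-zero (suc l))
violating-later i l L@(_ ∷ _) c = begin
  Σ< (suc l) (λ x → guard (c ≤ᵇ x) (q x ⊛ Violating i L x))
    ≈⟨ Σ<-congˢ (suc l) (λ x → ≈-trans
         (guard-cong (c ≤ᵇ x) (≈-trans (⊛-congʳ (q x) (violating-closed i L x)) (≈-sym (Σ<-⊛ˡ n (Tj x) (q x)))))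
         (guard-Σ< (c ≤ᵇ x) n (λ j → q x ⊛ Tj x j))) ⟩
  Σ< (suc l) (λ x → Σ< n (λ j → guard (c ≤ᵇ x) (q x ⊛ Tj x j)))
    ≈⟨ Σ<-swap (suc l) n (λ x j → guard (c ≤ᵇ x) (q x ⊛ Tj x j)) ⟩
  Σ< n (λ j → Σ< (suc l) (λ x → guard (c ≤ᵇ x) (q x ⊛ Tj x j)))
    ≈⟨ Σ<-congˢ n (λ j → ≈-trans (Σ<-congˢ (suc l) (regroup j)) (Σ<-⊛ʳ (suc l) _ (Uj j))) ⟩
  Σ< n (λ j → Bounded 1 (l ∷ take j L) c ⊛ Uj j) ∎
  where
  open ≈-Reasoning
  n = length L
  q : ℕ → PS
  q x = monomial (1 *ℕ x)
  Uj : ℕ → PS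
  Uj j = Unbounded i (n ∸ j) (suc (listAtN L j))
  Tj : ℕ → ℕ → PS
  Tj x j = Bounded 1 (take j L) x ⊛ Uj j
  coeff-one : ∀ j → partCoeff 1 (take j L) ≡ 1
  coeff-one j with take j L
  ... | []    = refl
  ... | _ ∷ _ = refl
  regroup : ∀ j x → guard (c ≤ᵇ x) (q x ⊛ Tj x j)
                    ≈ guard (c ≤ᵇ x) (monomial (partCoeff 1 (take j L) *ℕ x) ⊛ Bounded 1 (take j L) x) ⊛ Uj j
  regroup j x = ≈-trans
    (guard-cong (c ≤ᵇ x) (≈-trans (≈-sym (⊛-assoc (q x) (Bounded 1 (take j L) x) (Uj j)))
      (⊛-congˡ (Uj j) (⊛-congˡ (Bounded 1 (take j L) x) (monomial-cong (cong (_*ℕ x) (sym (coeff-one j))))))))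
    (≈-sym (guard-⊛ʳ (c ≤ᵇ x) _ (Uj j)))

-- Over lists, GL i ls c sums q^{i μ₁ + μ₂ + ⋯} over the
-- weakly decreasing μ ⊆ ls whose last part is ≥ c; peeling off the last (smallest) part
-- turns GL over ls into Bounded over the reversed, increasing list of bounds.

boxL : List ℕ → List (List ℕ)
boxL []       = [] ∷ []
boxL (l ∷ ls) = concatMap (λ x → map (x ∷_) (boxL ls)) (upTo (suc l))

decreasingL : List ℕ → Bool
decreasingL []           = true
decreasingL (x ∷ [])     = true
decreasingL (x ∷ y ∷ xs) = (y ≤ᵇ x) ∧ decreasingL (y ∷ xs)

lastAtLeast : ℕ → List ℕ → Bool
lastAtLeast c []           = true
lastAtLeast c (a ∷ [])     = c ≤ᵇ a
lastAtLeast c (a ∷ b ∷ xs) = lastAtLeast c (b ∷ xs)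

weightL : ℕ → List ℕ → ℕ
weightL i []       = 0
weightL i (x ∷ xs) = i *ℕ x +ℕ sumL xs

GL : ℕ → List ℕ → ℕ → PS
GL i ls c = ΣL (boxL ls) (λ μ → guard (decreasingL μ ∧ lastAtLeast c μ) (monomial (weightL i μ)))

box-toList : ∀ {n} (lam : Vec ℕ n) (H : List ℕ → PS) →
  ΣL (box lam) (λ μ → H (toList μ)) ≈ ΣL (boxL (toList lam)) H
box-toList Vec.[]         H = ≈-refl
box-toList (l Vec.∷ lam) H = begin
  ΣL (box (l Vec.∷ lam)) (λ μ → H (toList μ))
    ≈⟨ ΣL-concatMap (upTo (suc l)) (λ x → map (x Vec.∷_) (box lam)) (λ μ → H (toList μ)) ⟩
  ΣL (upTo (suc l)) (λ x → ΣL (map (x Vec.∷_) (box lam)) (λ μ → H (toList μ)))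
    ≈⟨ ΣL-cong (upTo (suc l)) (λ x → ≈-trans (ΣL-map (box lam) (x Vec.∷_) (λ μ → H (toList μ)))
         (≈-trans (box-toList lam (λ ν → H (x ∷ ν))) (≈-sym (ΣL-map (boxL (toList lam)) (x ∷_) H)))) ⟩
  ΣL (upTo (suc l)) (λ x → ΣL (map (x ∷_) (boxL (toList lam))) H)
    ≈⟨ ≈-sym (ΣL-concatMap (upTo (suc l)) (λ x → map (x ∷_) (boxL (toList lam))) H) ⟩
  ΣL (boxL (toList (l Vec.∷ lam))) H ∎
  where open ≈-Reasoning

decreasing-toList : ∀ {n} (μ : Vec ℕ n) → decreasingᵇ μ ≡ decreasingL (toList μ)
decreasing-toList Vec.[]                 = refl
decreasing-toList (x Vec.∷ Vec.[])       = refl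
decreasing-toList (x Vec.∷ y Vec.∷ μ)    = cong ((y ≤ᵇ x) ∧_) (decreasing-toList (y Vec.∷ μ))

weight-toList : ∀ {n} i (μ : Vec ℕ n) → weight i μ ≡ weightL i (toList μ)
weight-toList i Vec.[]        = refl
weight-toList i (x Vec.∷ μ)   = cong (i *ℕ x +ℕ_) (sum-toList μ)
  where
  sum-toList : ∀ {n} (μ : Vec ℕ n) → Vec.sum μ ≡ sumL (toList μ)
  sum-toList Vec.[]       = refl
  sum-toList (x Vec.∷ μ)  = cong (x +ℕ_) (sum-toList μ)

lastAtLeast-0 : ∀ μ → lastAtLeast 0 μ ≡ true
lastAtLeast-0 []          = refl
lastAtLeast-0 (a ∷ [])    = refl
lastAtLeast-0 (a ∷ b ∷ μ) = lastAtLeast-0 (b ∷ μ)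

G≈GL : ∀ {n} i (lam : Vec ℕ n) → G i lam ≈ GL i (toList lam) 0
G≈GL i lam = ≈-trans
  (ΣL-cong (box lam) (λ μ → ≈-reflexive (cong₂ (λ b w → if b then monomial w else zeroPS)
     (trans (decreasing-toList μ)
            (sym (trans (cong (decreasingL (toList μ) ∧_) (lastAtLeast-0 (toList μ))) (BoolP.∧-identityʳ _))))
     (weight-toList i μ))))
  (box-toList lam (λ μ → guard (decreasingL μ ∧ lastAtLeast 0 μ) (monomial (weightL i μ))))

boxL-cong : ∀ ls {F H : List ℕ → PS} → (∀ μ → length μ ≡ length ls → F μ ≈ H μ) →
  ΣL (boxL ls) F ≈ ΣL (boxL ls) H
boxL-cong []       h = ⊕-congˡ zeroPS (h [] refl)
boxL-cong (l ∷ ls) {F} {H} h = begin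
  ΣL (boxL (l ∷ ls)) F
    ≈⟨ ΣL-concatMap (upTo (suc l)) (λ x → map (x ∷_) (boxL ls)) F ⟩
  ΣL (upTo (suc l)) (λ x → ΣL (map (x ∷_) (boxL ls)) F)
    ≈⟨ ΣL-cong (upTo (suc l)) (λ x → ≈-trans (ΣL-map (boxL ls) (x ∷_) F)
         (≈-trans (boxL-cong ls (λ μ e → h (x ∷ μ) (cong suc e))) (≈-sym (ΣL-map (boxL ls) (x ∷_) H)))) ⟩
  ΣL (upTo (suc l)) (λ x → ΣL (map (x ∷_) (boxL ls)) H)
    ≈⟨ ≈-sym (ΣL-concatMap (upTo (suc l)) (λ x → map (x ∷_) (boxL ls)) H) ⟩
  ΣL (boxL (l ∷ ls)) H ∎
  where open ≈-Reasoning

boxL-snoc : ∀ ls l (H : List ℕ → PS) →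
  ΣL (boxL (ls ++ l ∷ [])) H ≈ ΣL (boxL ls) (λ μ → ΣL (upTo (suc l)) (λ x → H (μ ++ x ∷ [])))
boxL-snoc [] l H = begin
  ΣL (boxL (l ∷ [])) H                      ≈⟨ ΣL-concatMap (upTo (suc l)) (λ x → map (x ∷_) (boxL [])) H ⟩
  ΣL (upTo (suc l)) (λ x → H (x ∷ []) ⊕ zeroPS) ≈⟨ ΣL-cong (upTo (suc l)) (λ x → ⊕-identityʳ (H (x ∷ []))) ⟩
  ΣL (upTo (suc l)) (λ x → H (x ∷ []))       ≈⟨ ≈-sym (⊕-identityʳ _) ⟩
  ΣL (boxL []) (λ μ → ΣL (upTo (suc l)) (λ x → H (μ ++ x ∷ []))) ∎
  where open ≈-Reasoning
boxL-snoc (l₀ ∷ ls) l H = begin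
  ΣL (boxL (l₀ ∷ ls ++ l ∷ [])) H
    ≈⟨ ΣL-concatMap (upTo (suc l₀)) (λ x → map (x ∷_) (boxL (ls ++ l ∷ []))) H ⟩
  ΣL (upTo (suc l₀)) (λ x₀ → ΣL (map (x₀ ∷_) (boxL (ls ++ l ∷ []))) H)
    ≈⟨ ΣL-cong (upTo (suc l₀)) (λ x₀ → ≈-trans (ΣL-map (boxL (ls ++ l ∷ [])) (x₀ ∷_) H)
         (≈-trans (boxL-snoc ls l (λ μ → H (x₀ ∷ μ))) (≈-sym (ΣL-map (boxL ls) (x₀ ∷_) K)))) ⟩
  ΣL (upTo (suc l₀)) (λ x₀ → ΣL (map (x₀ ∷_) (boxL ls)) K)
    ≈⟨ ≈-sym (ΣL-concatMap (upTo (suc l₀)) (λ x → map (x ∷_) (boxL ls)) K) ⟩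
  ΣL (boxL (l₀ ∷ ls)) K ∎
  where
  open ≈-Reasoning
  K : List ℕ → PS
  K μ = ΣL (upTo (suc l)) (λ x → H (μ ++ x ∷ []))

decreasingL-snoc : ∀ μ x → decreasingL (μ ++ x ∷ []) ≡ decreasingL μ ∧ lastAtLeast x μ
decreasingL-snoc []          x = refl
decreasingL-snoc (a ∷ [])    x = BoolP.∧-identityʳ _
decreasingL-snoc (a ∷ b ∷ μ) x =
  trans (cong ((b ≤ᵇ a) ∧_) (decreasingL-snoc (b ∷ μ) x)) (sym (BoolP.∧-assoc (b ≤ᵇ a) _ _))

lastAtLeast-snoc : ∀ c μ x → lastAtLeast c (μ ++ x ∷ []) ≡ (c ≤ᵇ x)
lastAtLeast-snoc c []          x = refl
lastAtLeast-snoc c (a ∷ [])    x = refl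
lastAtLeast-snoc c (a ∷ b ∷ μ) x = lastAtLeast-snoc c (b ∷ μ) x

weightL-snoc : ∀ i a μ x → weightL i ((a ∷ μ) ++ x ∷ []) ≡ weightL i (a ∷ μ) +ℕ x
weightL-snoc i a μ x = begin
  i *ℕ a +ℕ sumL (μ ++ x ∷ [])           ≡⟨ cong (i *ℕ a +ℕ_) (ListActionP.sum-++ μ (x ∷ [])) ⟩
  i *ℕ a +ℕ (sumL μ +ℕ (x +ℕ 0))         ≡⟨ cong (λ z → i *ℕ a +ℕ (sumL μ +ℕ z)) (ℕP.+-identityʳ x) ⟩
  i *ℕ a +ℕ (sumL μ +ℕ x)                ≡⟨ sym (ℕP.+-assoc (i *ℕ a) (sumL μ) x) ⟩
  i *ℕ a +ℕ sumL μ +ℕ x                  ∎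
  where open ≡-Reasoning

guard-∧-monomial : ∀ p f w x → guard (p ∧ f) (monomial (w +ℕ x)) ≈ guard f (monomial x ⊛ guard p (monomial w))
guard-∧-monomial true  true  w x = ≈-trans (monomial-+ w x) (⊛-comm (monomial w) (monomial x))
guard-∧-monomial true  false w x = ≈-refl
guard-∧-monomial false true  w x = ≈-sym (⊛-zeroʳ (monomial x))
guard-∧-monomial false false w x = ≈-refl

GL-snoc : ∀ i ls l c → 1 ≤ length ls →
  GL i (ls ++ l ∷ []) c ≈ Σ< (suc l) (λ x → guard (c ≤ᵇ x) (monomial x ⊛ GL i ls x))
GL-snoc i ls l c 1≤ls = begin
  GL i (ls ++ l ∷ []) c
    ≈⟨ boxL-snoc ls l (summand c) ⟩
  ΣL (boxL ls) (λ μ → ΣL (upTo (suc l)) (λ x → summand c (μ ++ x ∷ [])))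
    ≈⟨ boxL-cong ls (λ μ e → ΣL-cong (upTo (suc l)) (λ x → last-part μ x (subst (1 ≤_) (sym e) 1≤ls))) ⟩
  ΣL (boxL ls) (λ μ → ΣL (upTo (suc l)) (λ x → guard (c ≤ᵇ x) (monomial x ⊛ summand x μ)))
    ≈⟨ ΣL-swap (boxL ls) (upTo (suc l)) (λ μ x → guard (c ≤ᵇ x) (monomial x ⊛ summand x μ)) ⟩
  ΣL (upTo (suc l)) (λ x → ΣL (boxL ls) (λ μ → guard (c ≤ᵇ x) (monomial x ⊛ summand x μ)))
    ≈⟨ ΣL-cong (upTo (suc l)) (λ x → ≈-trans (guard-ΣL (c ≤ᵇ x) (boxL ls) (λ μ → monomial x ⊛ summand x μ))
         (guard-cong (c ≤ᵇ x) (factor x))) ⟩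
  ΣL (upTo (suc l)) (λ x → guard (c ≤ᵇ x) (monomial x ⊛ GL i ls x))
    ≈⟨ ΣL-upTo (suc l) _ ⟩
  Σ< (suc l) (λ x → guard (c ≤ᵇ x) (monomial x ⊛ GL i ls x)) ∎
  where
  open ≈-Reasoning
  summand : ℕ → List ℕ → PS
  summand c μ = guard (decreasingL μ ∧ lastAtLeast c μ) (monomial (weightL i μ))
  last-part : ∀ μ x → 1 ≤ length μ → summand c (μ ++ x ∷ []) ≈ guard (c ≤ᵇ x) (monomial x ⊛ summand x μ)
  last-part (a ∷ μ) x _
    rewrite decreasingL-snoc (a ∷ μ) x | lastAtLeast-snoc c (a ∷ μ) x | weightL-snoc i a μ x =
    guard-∧-monomial (decreasingL (a ∷ μ) ∧ lastAtLeast x (a ∷ μ)) (c ≤ᵇ x) (weightL i (a ∷ μ)) x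
  factor : ∀ x → ΣL (boxL ls) (λ μ → monomial x ⊛ summand x μ) ≈ monomial x ⊛ GL i ls x
  factor x = ≈-trans (ΣL-cong (boxL ls) (λ μ → ⊛-comm (monomial x) (summand x μ)))
               (≈-trans (ΣL-⊛ʳ (boxL ls) (summand x) (monomial x)) (⊛-comm (GL i ls x) (monomial x)))

GL≈Bounded : ∀ i L c → GL i (reverse L) c ≈ Bounded i L c
GL≈Bounded i []              c = ≈-trans (⊕-identityʳ (monomial 0)) monomial-zero
GL≈Bounded i (l ∷ [])        c = begin
  GL i (l ∷ []) c
    ≈⟨ ΣL-concatMap (upTo (suc l)) (λ x → map (x ∷_) (boxL [])) H ⟩
  ΣL (upTo (suc l)) (λ x → H (x ∷ []) ⊕ zeroPS)
    ≈⟨ ΣL-cong (upTo (suc l)) (λ x → ≈-trans (⊕-identityʳ (H (x ∷ [])))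
         (guard-cong (c ≤ᵇ x) (≈-trans (monomial-cong (ℕP.+-identityʳ (i *ℕ x)))
                                       (≈-sym (⊛-identityʳ (monomial (i *ℕ x))))))) ⟩
  ΣL (upTo (suc l)) (λ x → guard (c ≤ᵇ x) (monomial (i *ℕ x) ⊛ onePS))
    ≈⟨ ΣL-upTo (suc l) _ ⟩
  Bounded i (l ∷ []) c ∎
  where
  open ≈-Reasoning
  H : List ℕ → PS
  H μ = guard (decreasingL μ ∧ lastAtLeast c μ) (monomial (weightL i μ))
GL≈Bounded i (l ∷ L@(_ ∷ _)) c = begin
  GL i (reverse (l ∷ L)) c
    ≈⟨ ≈-reflexive (cong (λ ls → GL i ls c) (ListP.unfold-reverse l L)) ⟩
  GL i (reverse L ++ l ∷ []) c
    ≈⟨ GL-snoc i (reverse L) l c (subst (1 ≤_) (sym (ListP.length-reverse L)) (s≤s z≤n)) ⟩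
  Σ< (suc l) (λ x → guard (c ≤ᵇ x) (monomial x ⊛ GL i (reverse L) x))
    ≈⟨ Σ<-congˢ (suc l) (λ x → guard-cong (c ≤ᵇ x)
         (⊛-cong (monomial-cong (sym (ℕP.*-identityˡ x))) (GL≈Bounded i L x))) ⟩
  Bounded i (l ∷ L) c ∎
  where open ≈-Reasoning

G≈Bounded : ∀ {n} i (lam : Vec ℕ n) → G i lam ≈ Bounded i (reverse (toList lam)) 0
G≈Bounded i lam = begin
  G i lam                                   ≈⟨ G≈GL i lam ⟩
  GL i (toList lam) 0                       ≈⟨ ≈-reflexive (cong (λ ls → GL i ls 0) (sym (ListP.reverse-involutive (toList lam)))) ⟩
  GL i (reverse (reverse (toList lam))) 0   ≈⟨ GL≈Bounded i (reverse (toList lam)) 0 ⟩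
  Bounded i (reverse (toList lam)) 0        ∎
  where open ≈-Reasoning

-- A subset A ⊆ [b] is read as its
-- list of membership bits, a partition as its list of parts; every ingredient of
-- `term` depends on the vectors only through these lists.

memberL : List Bool → ℕ → Bool
memberL as zero    = false
memberL as (suc k) = listAtB as k

-- max {t ≤ k | p t}, with max ∅ = 1
maxBelow : (ℕ → Bool) → ℕ → ℕ
maxBelow p zero    = 1
maxBelow p (suc k) = if p (suc k) then suc k else maxBelow p k

meetsBelow : (ℕ → Bool) → ℕ → Bool
meetsBelow p zero    = false
meetsBelow p (suc k) = p (suc k) ∨ meetsBelow p k

partL : List ℕ → ℕ → ℕ
partL ls zero    = 0
partL ls (suc j) = listAtN ls j

countTrue : List Bool → ℕ
countTrue []           = 0
countTrue (true ∷ as)  = suc (countTrue as)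
countTrue (false ∷ as) = countTrue as

fL : ℕ → List ℕ → List Bool → ℕ → ℕ
fL b ls as k = if meetsBelow (memberL as) k then partL ls (suc b ∸ maxBelow (memberL as) k) +ℕ 1 else 0

gL : List Bool → ℕ → ℕ
gL as k = k ∸ maxBelow (memberL as) k +ℕ 1

termL : ℕ → ℕ → List ℕ → List Bool → PS
termL b i ls as =
  scale (negOnePow (countTrue as))
    (monomial (sumNatFromTo 1 (b ∸ 1) (fL b ls as) +ℕ i *ℕ fL b ls as b)
      ⊛ (prodFromTo 1 (maxBelow (memberL as) b ∸ 1) (λ k → geom (gL as k))
      ⊛ prodFromTo (maxBelow (memberL as) b) b (λ k → geom (gL as k +ℕ i ∸ 1))))

maxUpTo-toList : ∀ {n} (A : Vec Bool n) k → maxUpTo A k ≡ maxBelow (memberL (toList A)) k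
maxUpTo-toList A zero    = refl
maxUpTo-toList A (suc k) = cong (if listAtB (toList A) k then suc k else_) (maxUpTo-toList A k)

meetsUpTo-toList : ∀ {n} (A : Vec Bool n) k → meetsUpTo A k ≡ meetsBelow (memberL (toList A)) k
meetsUpTo-toList A zero    = refl
meetsUpTo-toList A (suc k) = cong (listAtB (toList A) k ∨_) (meetsUpTo-toList A k)

card-toList : ∀ {n} (A : Vec Bool n) → card A ≡ countTrue (toList A)
card-toList Vec.[]           = refl
card-toList (true Vec.∷ A)   = cong suc (card-toList A)
card-toList (false Vec.∷ A)  = card-toList A

part-toList : ∀ {n} (lam : Vec ℕ n) k → part lam k ≡ partL (toList lam) k
part-toList lam zero    = refl
part-toList lam (suc k) = refl

f-toList : ∀ {b} (lam : Vec ℕ b) (A : Vec Bool b) k → f lam A k ≡ fL b (toList lam) (toList A) k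
f-toList {b} lam A k
  rewrite meetsUpTo-toList A k | maxUpTo-toList A k
        | part-toList lam (suc b ∸ maxBelow (memberL (toList A)) k) = refl

g-toList : ∀ {b} (A : Vec Bool b) k → g A k ≡ gL (toList A) k
g-toList A k rewrite maxUpTo-toList A k = refl

sumNatFromTo-cong : ∀ a c {F H : ℕ → ℕ} → (∀ k → F k ≡ H k) → sumNatFromTo a c F ≡ sumNatFromTo a c H
sumNatFromTo-cong a c h = cong (foldr _+ℕ_ 0) (ListP.map-cong h (fromTo a c))

prodFromTo-cong : ∀ a c {F H : ℕ → PS} → (∀ k → F k ≡ H k) → prodFromTo a c F ≡ prodFromTo a c H
prodFromTo-cong a c h = cong prodPS (ListP.map-cong h (fromTo a c))

term-toList : ∀ {b} i (lam : Vec ℕ b) (A : Vec Bool b) → term i lam A ≡ termL b i (toList lam) (toList A)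
term-toList {b} i lam A = cong₂ scale (cong negOnePow (card-toList A))
  (cong₂ _⊛_ (cong monomial (cong₂ _+ℕ_ (sumNatFromTo-cong 1 (b ∸ 1) (f-toList lam A))
                                       (cong (i *ℕ_) (f-toList lam A b))))
  (cong₂ _⊛_
     (trans (cong (λ M → prodFromTo 1 (M ∸ 1) (λ k → geom (g A k))) (maxUpTo-toList A b))
            (prodFromTo-cong 1 (M b ∸ 1) (λ k → cong geom (g-toList A k))))
     (trans (cong (λ M → prodFromTo M b (λ k → geom (g A k +ℕ i ∸ 1))) (maxUpTo-toList A b))
            (prodFromTo-cong (M b) b (λ k → cong (λ z → geom (z +ℕ i ∸ 1)) (g-toList A k))))))
  where
  M : ℕ → ℕ
  M = maxBelow (memberL (toList A))

ΣSub : ℕ → (List Bool → PS) → PS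
ΣSub n F = ΣL (allSubsets n) (λ A → F (toList A))

RHS≈ΣSub : ∀ {b} i (lam : Vec ℕ b) → RHS i lam ≈ ΣSub b (termL b i (toList lam))
RHS≈ΣSub {b} i lam = ≈-reflexive (cong sumPS (ListP.map-cong (term-toList i lam) (allSubsets b)))

ΣSub-cong : ∀ n {F H : List Bool → PS} → (∀ as → length as ≡ n → F as ≈ H as) → ΣSub n F ≈ ΣSub n H
ΣSub-cong n h = ΣL-cong (allSubsets n) (λ A → h (toList A) (VecP.length-toList A))

ΣSub-⊕ : ∀ n F H → ΣSub n (λ as → F as ⊕ H as) ≈ ΣSub n F ⊕ ΣSub n H
ΣSub-⊕ n F H = ΣL-⊕ (allSubsets n) (λ A → F (toList A)) (λ A → H (toList A))

ΣSub-scale-⊛ : ∀ n c F K → ΣSub n (λ as → scale c (F as ⊛ K)) ≈ scale c (ΣSub n F ⊛ K)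
ΣSub-scale-⊛ n c F K = ≈-trans (ΣL-scale (allSubsets n) c (λ A → F (toList A) ⊛ K))
                         (scale-cong c (ΣL-⊛ʳ (allSubsets n) (λ A → F (toList A)) K))

ΣSub-suc : ∀ n F → ΣSub (suc n) F ≈ ΣSub n (λ as → F (true ∷ as) ⊕ F (false ∷ as))
ΣSub-suc n F = ≈-trans
  (ΣL-concatMap (allSubsets n) (λ A → (true Vec.∷ A) ∷ (false Vec.∷ A) ∷ []) (λ A → F (toList A)))
  (ΣL-cong (allSubsets n) (λ A → ⊕-congʳ (F (true ∷ toList A)) (⊕-identityʳ (F (false ∷ toList A)))))

ΣSub-snoc : ∀ n F → ΣSub (suc n) F ≈ ΣSub n (λ as → F (as ++ true ∷ []) ⊕ F (as ++ false ∷ []))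
ΣSub-snoc zero    F = ΣSub-suc 0 F
ΣSub-snoc (suc n) F = begin
  ΣSub (suc (suc n)) F
    ≈⟨ ΣSub-suc (suc n) F ⟩
  ΣSub (suc n) (λ as → F (true ∷ as) ⊕ F (false ∷ as))
    ≈⟨ ΣSub-snoc n (λ as → F (true ∷ as) ⊕ F (false ∷ as)) ⟩
  ΣSub n (λ as → (F (true ∷ as ++ true ∷ []) ⊕ F (false ∷ as ++ true ∷ []))
               ⊕ (F (true ∷ as ++ false ∷ []) ⊕ F (false ∷ as ++ false ∷ [])))
    ≈⟨ ΣSub-cong n (λ as _ → ⊕-interchange (F (true ∷ as ++ true ∷ [])) (F (false ∷ as ++ true ∷ []))
                                             (F (true ∷ as ++ false ∷ [])) (F (false ∷ as ++ false ∷ []))) ⟩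
  ΣSub n (λ as → (F (true ∷ as ++ true ∷ []) ⊕ F (true ∷ as ++ false ∷ []))
               ⊕ (F (false ∷ as ++ true ∷ []) ⊕ F (false ∷ as ++ false ∷ [])))
    ≈⟨ ≈-sym (ΣSub-suc n (λ as → F (as ++ true ∷ []) ⊕ F (as ++ false ∷ []))) ⟩
  ΣSub (suc n) (λ as → F (as ++ true ∷ []) ⊕ F (as ++ false ∷ [])) ∎
  where open ≈-Reasoning

replicate-snoc : ∀ k (x : Bool) Z → replicate k x ++ x ∷ Z ≡ x ∷ replicate k x ++ Z
replicate-snoc zero    x Z = refl
replicate-snoc (suc k) x Z = cong (x ∷_) (replicate-snoc k x Z)

-- classifying the subsets of [k] by their largest element j + 1 (or emptiness):
--   Σ_{A ⊆ [k]} F A = F ∅ + Σ_{j<k} Σ_{A' ⊆ [j]} F (A' ∪ {j+1}),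
-- stated with a fixed suffix Z to make the induction on k go through
ΣSub-byMax : ∀ k (Z : List Bool) (F : List Bool → PS) →
  ΣSub k (λ as → F (as ++ Z)) ≈
    F (replicate k false ++ Z) ⊕ Σ< k (λ j → ΣSub j (λ as → F (as ++ true ∷ replicate (k ∸ suc j) false ++ Z)))
ΣSub-byMax zero    Z F = ≈-refl
ΣSub-byMax (suc k) Z F = begin
  ΣSub (suc k) (λ as → F (as ++ Z))
    ≈⟨ ΣSub-snoc k (λ as → F (as ++ Z)) ⟩
  ΣSub k (λ as → F ((as ++ true ∷ []) ++ Z) ⊕ F ((as ++ false ∷ []) ++ Z))
    ≈⟨ ΣSub-cong k (λ as _ → ⊕-cong (≈-reflexive (cong F (ListP.++-assoc as (true ∷ []) Z)))
                                    (≈-reflexive (cong F (ListP.++-assoc as (false ∷ []) Z)))) ⟩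
  ΣSub k (λ as → F (as ++ true ∷ Z) ⊕ F (as ++ false ∷ Z))
    ≈⟨ ΣSub-⊕ k (λ as → F (as ++ true ∷ Z)) (λ as → F (as ++ false ∷ Z)) ⟩
  Top ⊕ ΣSub k (λ as → F (as ++ false ∷ Z))
    ≈⟨ ⊕-congʳ Top (ΣSub-byMax k (false ∷ Z) F) ⟩
  Top ⊕ (F (replicate k false ++ false ∷ Z)
           ⊕ Σ< k (λ j → ΣSub j (λ as → F (as ++ true ∷ replicate (k ∸ suc j) false ++ false ∷ Z))))
    ≈⟨ ⊕-congʳ Top (⊕-cong (≈-reflexive (cong F (replicate-snoc k false Z)))
                           (Σ<-cong k (λ j j<k → ΣSub-cong j (λ as _ →
                              ≈-reflexive (cong (λ z → F (as ++ true ∷ z)) (pad j j<k)))))) ⟩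
  Top ⊕ (F (replicate (suc k) false ++ Z) ⊕ Lower)
    ≈⟨ ≈-trans (⊕-comm Top _) (⊕-assoc (F (replicate (suc k) false ++ Z)) Lower Top) ⟩
  F (replicate (suc k) false ++ Z) ⊕ (Lower ⊕ Top)
    ≈⟨ ⊕-congʳ (F (replicate (suc k) false ++ Z)) (⊕-congʳ Lower (ΣSub-cong k (λ as _ →
         ≈-reflexive (cong (λ m → F (as ++ true ∷ replicate m false ++ Z)) (sym (ℕP.n∸n≡0 k)))))) ⟩
  F (replicate (suc k) false ++ Z)
    ⊕ Σ< (suc k) (λ j → ΣSub j (λ as → F (as ++ true ∷ replicate (suc k ∸ suc j) false ++ Z))) ∎
  where
  open ≈-Reasoning
  Top = ΣSub k (λ as → F (as ++ true ∷ Z))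
  Lower = Σ< k (λ j → ΣSub j (λ as → F (as ++ true ∷ replicate (suc k ∸ suc j) false ++ Z)))
  pad : ∀ j → j < k → replicate (k ∸ suc j) false ++ false ∷ Z ≡ replicate (suc k ∸ suc j) false ++ Z
  pad j j<k rewrite ℕP.+-∸-assoc 1 j<k = replicate-snoc (k ∸ suc j) false Z

listAtB-++ˡ : ∀ as Z k → k < length as → listAtB (as ++ Z) k ≡ listAtB as k
listAtB-++ˡ (a ∷ as) Z zero    _       = refl
listAtB-++ˡ (a ∷ as) Z (suc k) (s≤s p) = listAtB-++ˡ as Z k p

listAtB-++ʳ : ∀ as Z m → listAtB (as ++ Z) (length as +ℕ m) ≡ listAtB Z m
listAtB-++ʳ []       Z m = refl
listAtB-++ʳ (a ∷ as) Z m = listAtB-++ʳ as Z m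

listAtB-replicate : ∀ r m → listAtB (replicate r false) m ≡ false
listAtB-replicate zero    m       = refl
listAtB-replicate (suc r) zero    = refl
listAtB-replicate (suc r) (suc m) = listAtB-replicate r m

listAtN-drop : ∀ d xs y → listAtN (drop d xs) y ≡ listAtN xs (d +ℕ y)
listAtN-drop zero    xs       y = refl
listAtN-drop (suc d) []       y = refl
listAtN-drop (suc d) (x ∷ xs) y = listAtN-drop d xs y

listAtN-++ˡ : ∀ xs Z k → k < length xs → listAtN (xs ++ Z) k ≡ listAtN xs k
listAtN-++ˡ (a ∷ xs) Z zero    _       = refl
listAtN-++ˡ (a ∷ xs) Z (suc k) (s≤s p) = listAtN-++ˡ xs Z k p

listAtN-++-length : ∀ xs Z → listAtN (xs ++ Z) (length xs) ≡ listAtN Z 0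
listAtN-++-length []       Z = refl
listAtN-++-length (a ∷ xs) Z = listAtN-++-length xs Z

listAtN-reverse : ∀ xs k → k < length xs → listAtN (reverse xs) k ≡ listAtN xs (length xs ∸ suc k)
listAtN-reverse (x ∷ xs) k (s≤s p) with ℕP.m≤n⇒m<n∨m≡n p
... | inj₁ k<xs = begin
  listAtN (reverse (x ∷ xs)) k      ≡⟨ cong (λ z → listAtN z k) (ListP.unfold-reverse x xs) ⟩
  listAtN (reverse xs ++ x ∷ []) k  ≡⟨ listAtN-++ˡ (reverse xs) (x ∷ []) k (subst (k <_) (sym (ListP.length-reverse xs)) k<xs) ⟩
  listAtN (reverse xs) k            ≡⟨ listAtN-reverse xs k k<xs ⟩
  listAtN xs (length xs ∸ suc k)    ≡⟨ cong (listAtN (x ∷ xs)) (sym (ℕP.+-∸-assoc 1 k<xs)) ⟩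
  listAtN (x ∷ xs) (length xs ∸ k)  ∎
  where open ≡-Reasoning
... | inj₂ refl = begin
  listAtN (reverse (x ∷ xs)) k                           ≡⟨ cong (λ z → listAtN z k) (ListP.unfold-reverse x xs) ⟩
  listAtN (reverse xs ++ x ∷ []) (length xs)             ≡⟨ cong (listAtN (reverse xs ++ x ∷ [])) (sym (ListP.length-reverse xs)) ⟩
  listAtN (reverse xs ++ x ∷ []) (length (reverse xs))   ≡⟨ listAtN-++-length (reverse xs) (x ∷ []) ⟩
  x                                                      ≡⟨ cong (listAtN (x ∷ xs)) (sym (ℕP.n∸n≡0 (length xs))) ⟩
  listAtN (x ∷ xs) (length xs ∸ length xs)               ∎
  where open ≡-Reasoning

maxBelow-local : ∀ p q k → (∀ t → t ≤ k → p t ≡ q t) → maxBelow p k ≡ maxBelow q k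
maxBelow-local p q zero    h = refl
maxBelow-local p q (suc k) h rewrite h (suc k) ℕP.≤-refl =
  cong (if q (suc k) then suc k else_) (maxBelow-local p q k (λ t r → h t (ℕP.m≤n⇒m≤1+n r)))

meetsBelow-local : ∀ p q k → (∀ t → t ≤ k → p t ≡ q t) → meetsBelow p k ≡ meetsBelow q k
meetsBelow-local p q zero    h = refl
meetsBelow-local p q (suc k) h =
  cong₂ _∨_ (h (suc k) ℕP.≤-refl) (meetsBelow-local p q k (λ t r → h t (ℕP.m≤n⇒m≤1+n r)))

maxBelow-top : ∀ p j k → p (suc j) ≡ true → (∀ t → suc j < t → p t ≡ false) → suc j ≤ k →
  maxBelow p k ≡ suc j
maxBelow-top p j (suc k) pj above (s≤s j≤k) with ℕP.m≤n⇒m<n∨m≡n j≤k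
... | inj₂ refl rewrite pj = refl
... | inj₁ j<k  rewrite above (suc k) (s≤s j<k) = maxBelow-top p j k pj above j<k

meetsBelow-top : ∀ p j k → p (suc j) ≡ true → suc j ≤ k → meetsBelow p k ≡ true
meetsBelow-top p j (suc k) pj (s≤s j≤k) with ℕP.m≤n⇒m<n∨m≡n j≤k
... | inj₂ refl rewrite pj = refl
... | inj₁ j<k  rewrite meetsBelow-top p j k pj j<k = BoolP.∨-zeroʳ (p (suc k))

maxBelow-≥1 : ∀ p k → 1 ≤ maxBelow p k
maxBelow-≥1 p zero    = ℕP.≤-refl
maxBelow-≥1 p (suc k) with p (suc k)
... | true  = s≤s z≤n
... | false = maxBelow-≥1 p k

maxBelow-≤ : ∀ p k → maxBelow p k ≤ suc k
maxBelow-≤ p zero    = ℕP.≤-refl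
maxBelow-≤ p (suc k) with p (suc k)
... | true  = ℕP.n≤1+n (suc k)
... | false = ℕP.m≤n⇒m≤1+n (maxBelow-≤ p k)

maxBelow-≤-meets : ∀ p k → meetsBelow p k ≡ true → maxBelow p k ≤ k
maxBelow-≤-meets p (suc k) m with p (suc k)
... | true  = ℕP.≤-refl
... | false = ℕP.m≤n⇒m≤1+n (maxBelow-≤-meets p k m)

maxBelow-empty : ∀ p k → (∀ t → p t ≡ false) → maxBelow p k ≡ 1
maxBelow-empty p zero    h = refl
maxBelow-empty p (suc k) h rewrite h (suc k) = maxBelow-empty p k h

meetsBelow-empty : ∀ p k → (∀ t → p t ≡ false) → meetsBelow p k ≡ false
meetsBelow-empty p zero    h = refl
meetsBelow-empty p (suc k) h rewrite h (suc k) = meetsBelow-empty p k h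

sumFrom1 : ℕ → (ℕ → ℕ) → ℕ
sumFrom1 zero    F = 0
sumFrom1 (suc n) F = sumFrom1 n F +ℕ F (suc n)

sumNatFromTo-sumFrom1 : ∀ n F → sumNatFromTo 1 n F ≡ sumFrom1 n F
sumNatFromTo-sumFrom1 zero    F = refl
sumNatFromTo-sumFrom1 (suc n) F = begin
  sumL (map F (map suc (upTo (suc n))))              ≡⟨ cong (λ z → sumL (map F (map suc z))) (sym (ListP.upTo-∷ʳ n)) ⟩
  sumL (map F (map suc (upTo n ++ n ∷ [])))          ≡⟨ cong (λ z → sumL (map F z)) (ListP.map-++ suc (upTo n) (n ∷ [])) ⟩
  sumL (map F (map suc (upTo n) ++ suc n ∷ []))      ≡⟨ cong sumL (ListP.map-++ F (map suc (upTo n)) (suc n ∷ [])) ⟩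
  sumL (map F (map suc (upTo n)) ++ F (suc n) ∷ [])  ≡⟨ ListActionP.sum-++ (map F (map suc (upTo n))) (F (suc n) ∷ []) ⟩
  sumNatFromTo 1 n F +ℕ (F (suc n) +ℕ 0)             ≡⟨ cong₂ _+ℕ_ (sumNatFromTo-sumFrom1 n F) (ℕP.+-identityʳ _) ⟩
  sumFrom1 n F +ℕ F (suc n)                          ∎
  where open ≡-Reasoning

sumFrom1-cong : ∀ n {F H : ℕ → ℕ} → (∀ k → k ≤ n → F k ≡ H k) → sumFrom1 n F ≡ sumFrom1 n H
sumFrom1-cong zero    h = refl
sumFrom1-cong (suc n) h = cong₂ _+ℕ_ (sumFrom1-cong n (λ k p → h k (ℕP.m≤n⇒m≤1+n p))) (h (suc n) ℕP.≤-refl)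

sumFrom1-constTail : ∀ j r (F : ℕ → ℕ) C → (∀ k → suc j ≤ k → F k ≡ C) →
  sumFrom1 (j +ℕ r) F ≡ sumFrom1 j F +ℕ r *ℕ C
sumFrom1-constTail j zero    F C h =
  trans (cong (λ z → sumFrom1 z F) (ℕP.+-identityʳ j)) (sym (ℕP.+-identityʳ _))
sumFrom1-constTail j (suc r) F C h = begin
  sumFrom1 (j +ℕ suc r) F                  ≡⟨ cong (λ z → sumFrom1 z F) (ℕP.+-suc j r) ⟩
  sumFrom1 (j +ℕ r) F +ℕ F (suc (j +ℕ r))  ≡⟨ cong₂ _+ℕ_ (sumFrom1-constTail j r F C h) (h (suc (j +ℕ r)) (s≤s (ℕP.m≤m+n j r))) ⟩
  sumFrom1 j F +ℕ r *ℕ C +ℕ C              ≡⟨ ℕP.+-assoc (sumFrom1 j F) _ C ⟩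
  sumFrom1 j F +ℕ (r *ℕ C +ℕ C)            ≡⟨ cong (sumFrom1 j F +ℕ_) (ℕP.+-comm (r *ℕ C) C) ⟩
  sumFrom1 j F +ℕ suc r *ℕ C               ∎
  where open ≡-Reasoning

prodRange : ℕ → ℕ → (ℕ → PS) → PS
prodRange a zero    F = onePS
prodRange a (suc n) F = prodRange a n F ⊛ F (a +ℕ n)

prodPS-snoc : ∀ xs y → prodPS (xs ++ y ∷ []) ≈ prodPS xs ⊛ y
prodPS-snoc []       y = ≈-trans (⊛-identityʳ y) (≈-sym (⊛-identityˡ y))
prodPS-snoc (x ∷ xs) y = ≈-trans (⊛-congʳ x (prodPS-snoc xs y)) (≈-sym (⊛-assoc x (prodPS xs) y))

prodPS-range : ∀ a n F → prodPS (map F (map (a +ℕ_) (upTo n))) ≈ prodRange a n F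
prodPS-range a zero    F = ≈-refl
prodPS-range a (suc n) F = begin
  prodPS (map F (map (a +ℕ_) (upTo (suc n))))
    ≈⟨ ≈-reflexive (cong (λ z → prodPS (map F (map (a +ℕ_) z))) (sym (ListP.upTo-∷ʳ n))) ⟩
  prodPS (map F (map (a +ℕ_) (upTo n ++ n ∷ [])))
    ≈⟨ ≈-reflexive (cong (λ z → prodPS (map F z)) (ListP.map-++ (a +ℕ_) (upTo n) (n ∷ []))) ⟩
  prodPS (map F (map (a +ℕ_) (upTo n) ++ a +ℕ n ∷ []))
    ≈⟨ ≈-reflexive (cong prodPS (ListP.map-++ F (map (a +ℕ_) (upTo n)) (a +ℕ n ∷ []))) ⟩
  prodPS (map F (map (a +ℕ_) (upTo n)) ++ F (a +ℕ n) ∷ [])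
    ≈⟨ prodPS-snoc (map F (map (a +ℕ_) (upTo n))) (F (a +ℕ n)) ⟩
  prodPS (map F (map (a +ℕ_) (upTo n))) ⊛ F (a +ℕ n)
    ≈⟨ ⊛-congˡ (F (a +ℕ n)) (prodPS-range a n F) ⟩
  prodRange a (suc n) F ∎
  where open ≈-Reasoning

prodFromTo-range : ∀ a c F → prodFromTo a c F ≈ prodRange a (suc c ∸ a) F
prodFromTo-range a c F = prodPS-range a (suc c ∸ a) F

prodRange-cong : ∀ a n {F H : ℕ → PS} → (∀ t → t < n → F (a +ℕ t) ≡ H (a +ℕ t)) →
  prodRange a n F ≈ prodRange a n H
prodRange-cong a zero    h = ≈-refl
prodRange-cong a (suc n) {F} {H} h = ⊛-cong
  (prodRange-cong a n (λ t p → h t (ℕP.m<n⇒m<1+n p)))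
  (≈-reflexive (h n ℕP.≤-refl))

prodRange-+ : ∀ a p q F → prodRange a (p +ℕ q) F ≈ prodRange a p F ⊛ prodRange (a +ℕ p) q F
prodRange-+ a p zero    F = ≈-trans (≈-reflexive (cong (λ z → prodRange a z F) (ℕP.+-identityʳ p)))
                                    (≈-sym (⊛-identityʳ (prodRange a p F)))
prodRange-+ a p (suc q) F = begin
  prodRange a (p +ℕ suc q) F
    ≈⟨ ≈-reflexive (cong (λ z → prodRange a z F) (ℕP.+-suc p q)) ⟩
  prodRange a (p +ℕ q) F ⊛ F (a +ℕ (p +ℕ q))
    ≈⟨ ⊛-congˡ (F (a +ℕ (p +ℕ q))) (prodRange-+ a p q F) ⟩
  (prodRange a p F ⊛ prodRange (a +ℕ p) q F) ⊛ F (a +ℕ (p +ℕ q))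
    ≈⟨ ⊛-assoc (prodRange a p F) (prodRange (a +ℕ p) q F) (F (a +ℕ (p +ℕ q))) ⟩
  prodRange a p F ⊛ (prodRange (a +ℕ p) q F ⊛ F (a +ℕ (p +ℕ q)))
    ≈⟨ ≈-reflexive (cong (λ z → prodRange a p F ⊛ (prodRange (a +ℕ p) q F ⊛ F z)) (sym (ℕP.+-assoc a p q))) ⟩
  prodRange a p F ⊛ prodRange (a +ℕ p) (suc q) F ∎
  where open ≈-Reasoning

geomProd-range : ∀ i a n F → (∀ t → t < n → F (a +ℕ t) ≡ geom (t +ℕ i)) → geomProd i n ≈ prodRange a n F
geomProd-range i a zero    F h = ≈-refl
geomProd-range i a (suc n) F h = ≈-trans (⊛-comm (geom (n +ℕ i)) (geomProd i n))
  (⊛-cong (geomProd-range i a n F (λ t p → h t (ℕP.m<n⇒m<1+n p))) (≈-reflexive (sym (h n ℕP.≤-refl))))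

prodFromTo-split : ∀ M j (F : ℕ → PS) → 1 ≤ M → M ≤ suc j →
  prodFromTo 1 (M ∸ 1) F ⊛ prodFromTo M j F ≈ prodRange 1 j F
prodFromTo-split (suc M) j F _ (s≤s M≤j) = begin
  prodFromTo 1 M F ⊛ prodFromTo (suc M) j F  ≈⟨ ⊛-cong (prodFromTo-range 1 M F) (prodFromTo-range (suc M) j F) ⟩
  prodRange 1 M F ⊛ prodRange (suc M) (j ∸ M) F ≈⟨ ≈-sym (prodRange-+ 1 M (j ∸ M) F) ⟩
  prodRange 1 (M +ℕ (j ∸ M)) F              ≈⟨ ≈-reflexive (cong (λ z → prodRange 1 z F) (ℕP.m+[n∸m]≡n M≤j)) ⟩
  prodRange 1 j F                           ∎
  where open ≈-Reasoning

-- For A = ∅ the summand is the unbounded series; for A with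
-- largest element j + 1 (and b = j + 1 + r) it is minus the summand of A' = A ∖ {j+1}
-- for the last j parts with i = 1, times an unbounded series in the first r + 1 parts.

partL-below : ∀ xs n M → M ≤ n → partL xs (suc n ∸ M) ≡ listAtN xs (n ∸ M)
partL-below xs n M M≤n rewrite ℕP.+-∸-assoc 1 M≤n = refl

countTrue-replicate : ∀ r → countTrue (replicate r false) ≡ 0
countTrue-replicate zero    = refl
countTrue-replicate (suc r) = countTrue-replicate r

countTrue-snoc-top : ∀ as r → countTrue (as ++ true ∷ replicate r false) ≡ suc (countTrue as)
countTrue-snoc-top []           r = cong suc (countTrue-replicate r)
countTrue-snoc-top (true ∷ as)  r = cong suc (countTrue-snoc-top as r)
countTrue-snoc-top (false ∷ as) r = countTrue-snoc-top as r

exponent-i≡1 : ∀ j (F : ℕ → ℕ) → F 0 ≡ 0 → sumNatFromTo 1 (j ∸ 1) F +ℕ 1 *ℕ F j ≡ sumFrom1 j F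
exponent-i≡1 zero    F F0 rewrite F0 = refl
exponent-i≡1 (suc j) F F0 = cong₂ _+ℕ_ (sumNatFromTo-sumFrom1 j F) (ℕP.*-identityˡ (F (suc j)))

-- g(k) + i - 1 = t + i whenever g(k) = t + 1
shifted-index : ∀ t i → t +ℕ 1 +ℕ i ∸ 1 ≡ t +ℕ i
shifted-index t i = cong (_∸ 1) (trans (ℕP.+-assoc t 1 i) (ℕP.+-suc t i))

-- the subset A = A' ∪ {j+1} of [b], b = j + 1 + r, given by the bits as of A' ⊆ [j],
-- for the partition ls with b parts
module LargestElement (i : ℕ) (as : List Bool) (r : ℕ) (ls : List ℕ) where

  j = length as
  b = j +ℕ suc r
  A = as ++ true ∷ replicate r false
  inA = memberL A
  inA' = memberL as
  ls' = drop (suc r) ls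
  C = listAtN ls r +ℕ 1

  inA-below : ∀ k → k ≤ j → inA k ≡ inA' k
  inA-below zero    _   = refl
  inA-below (suc k) k<j = listAtB-++ˡ as (true ∷ replicate r false) k k<j

  inA-top : inA (suc j) ≡ true
  inA-top = trans (cong (listAtB A) (sym (ℕP.+-identityʳ j))) (listAtB-++ʳ as (true ∷ replicate r false) 0)

  inA-above : ∀ t → suc j < t → inA t ≡ false
  inA-above (suc t) (s≤s j<t) = begin
    listAtB A t                                         ≡⟨ cong (listAtB A) (sym (ℕP.m+[n∸m]≡n (ℕP.<⇒≤ j<t))) ⟩
    listAtB A (j +ℕ (t ∸ j))                            ≡⟨ listAtB-++ʳ as (true ∷ replicate r false) (t ∸ j) ⟩
    listAtB (true ∷ replicate r false) (t ∸ j)          ≡⟨ cong (listAtB (true ∷ replicate r false)) (ℕP.+-∸-assoc 1 j<t) ⟩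
    listAtB (replicate r false) (t ∸ suc j)             ≡⟨ listAtB-replicate r (t ∸ suc j) ⟩
    false                                               ∎
    where open ≡-Reasoning

  1+j≤b : suc j ≤ b
  1+j≤b = subst (suc j ≤_) (sym (ℕP.+-suc j r)) (s≤s (ℕP.m≤m+n j r))

  b∸j : b ∸ j ≡ suc r
  b∸j = ℕP.m+n∸m≡n j (suc r)

  max-above : ∀ k → suc j ≤ k → maxBelow inA k ≡ suc j
  max-above k = maxBelow-top inA j k inA-top inA-above

  max-below : ∀ k → k ≤ j → maxBelow inA k ≡ maxBelow inA' k
  max-below k k≤j = maxBelow-local inA inA' k (λ t t≤k → inA-below t (ℕP.≤-trans t≤k k≤j))

  meets-below : ∀ k → k ≤ j → meetsBelow inA k ≡ meetsBelow inA' k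
  meets-below k k≤j = meetsBelow-local inA inA' k (λ t t≤k → inA-below t (ℕP.≤-trans t≤k k≤j))

  f-above : ∀ k → suc j ≤ k → fL b ls A k ≡ C
  f-above k 1+j≤k rewrite meetsBelow-top inA j k inA-top 1+j≤k | max-above k 1+j≤k | b∸j = refl

  f-below : ∀ k → k ≤ j → fL b ls A k ≡ fL j ls' as k
  f-below k k≤j rewrite meets-below k k≤j | max-below k k≤j with meetsBelow inA' k in meets
  ... | false = refl
  ... | true  = cong (_+ℕ 1) (begin
    partL ls (suc b ∸ M)          ≡⟨ partL-below ls b M (ℕP.≤-trans M≤j (ℕP.m≤m+n j (suc r))) ⟩
    listAtN ls (b ∸ M)            ≡⟨ cong (listAtN ls) (trans (ℕP.+-∸-comm (suc r) M≤j) (ℕP.+-comm (j ∸ M) (suc r))) ⟩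
    listAtN ls (suc r +ℕ (j ∸ M)) ≡⟨ sym (listAtN-drop (suc r) ls (j ∸ M)) ⟩
    listAtN ls' (j ∸ M)           ≡⟨ sym (partL-below ls' j M M≤j) ⟩
    partL ls' (suc j ∸ M)         ∎)
    where
    open ≡-Reasoning
    M = maxBelow inA' k
    M≤j : M ≤ j
    M≤j = ℕP.≤-trans (maxBelow-≤-meets inA' k meets) k≤j

  exponentA = sumNatFromTo 1 (b ∸ 1) (fL b ls A) +ℕ i *ℕ fL b ls A b
  exponentA' = sumNatFromTo 1 (j ∸ 1) (fL j ls' as) +ℕ 1 *ℕ fL j ls' as j

  exponent-split : exponentA ≡ exponentA' +ℕ C *ℕ (r +ℕ i)
  exponent-split = begin
    sumNatFromTo 1 (b ∸ 1) (fL b ls A) +ℕ i *ℕ fL b ls A b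
      ≡⟨ cong₂ _+ℕ_ (trans (cong (λ z → sumNatFromTo 1 z (fL b ls A)) (cong (_∸ 1) (ℕP.+-suc j r)))
                           (sumNatFromTo-sumFrom1 (j +ℕ r) (fL b ls A)))
                    (cong (i *ℕ_) (f-above b 1+j≤b)) ⟩
    sumFrom1 (j +ℕ r) (fL b ls A) +ℕ i *ℕ C
      ≡⟨ cong (_+ℕ i *ℕ C) (sumFrom1-constTail j r (fL b ls A) C f-above) ⟩
    sumFrom1 j (fL b ls A) +ℕ r *ℕ C +ℕ i *ℕ C
      ≡⟨ cong (λ z → z +ℕ r *ℕ C +ℕ i *ℕ C) (sumFrom1-cong j f-below) ⟩
    sumFrom1 j (fL j ls' as) +ℕ r *ℕ C +ℕ i *ℕ C
      ≡⟨ collect (sumFrom1 j (fL j ls' as)) r i C ⟩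
    sumFrom1 j (fL j ls' as) +ℕ C *ℕ (r +ℕ i)
      ≡⟨ cong (_+ℕ C *ℕ (r +ℕ i)) (sym (exponent-i≡1 j (fL j ls' as) refl)) ⟩
    exponentA' +ℕ C *ℕ (r +ℕ i) ∎
    where
    open ≡-Reasoning
    collect : ∀ a r i C → a +ℕ r *ℕ C +ℕ i *ℕ C ≡ a +ℕ C *ℕ (r +ℕ i)
    collect = ℕSolver.solve-∀

  first-product : prodFromTo 1 (maxBelow inA b ∸ 1) (λ k → geom (gL A k)) ≈ prodRange 1 j (λ k → geom (gL as k))
  first-product = begin
    prodFromTo 1 (maxBelow inA b ∸ 1) (λ k → geom (gL A k))
      ≈⟨ ≈-reflexive (cong (λ z → prodFromTo 1 (z ∸ 1) (λ k → geom (gL A k))) (max-above b 1+j≤b)) ⟩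
    prodFromTo 1 j (λ k → geom (gL A k))
      ≈⟨ prodFromTo-range 1 j (λ k → geom (gL A k)) ⟩
    prodRange 1 j (λ k → geom (gL A k))
      ≈⟨ prodRange-cong 1 j (λ t t<j → cong (λ z → geom (suc t ∸ z +ℕ 1)) (max-below (suc t) t<j)) ⟩
    prodRange 1 j (λ k → geom (gL as k)) ∎
    where open ≈-Reasoning

  productsA' = prodFromTo 1 (maxBelow inA' j ∸ 1) (λ k → geom (gL as k))
             ⊛ prodFromTo (maxBelow inA' j) j (λ k → geom (gL as k +ℕ 1 ∸ 1))

  products-A' : productsA' ≈ prodRange 1 j (λ k → geom (gL as k))
  products-A' = ≈-trans
    (⊛-congʳ (prodFromTo 1 (maxBelow inA' j ∸ 1) (λ k → geom (gL as k)))
      (≈-reflexive (cong prodPS (ListP.map-cong (λ k → cong geom (ℕP.m+n∸n≡m (gL as k) 1))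
                                                (fromTo (maxBelow inA' j) j)))))
    (prodFromTo-split (maxBelow inA' j) j (λ k → geom (gL as k)) (maxBelow-≥1 inA' j) (maxBelow-≤ inA' j))

  index-above : ∀ t → gL A (suc j +ℕ t) +ℕ i ∸ 1 ≡ t +ℕ i
  index-above t = begin
    suc j +ℕ t ∸ maxBelow inA (suc j +ℕ t) +ℕ 1 +ℕ i ∸ 1
      ≡⟨ cong (λ z → suc j +ℕ t ∸ z +ℕ 1 +ℕ i ∸ 1) (max-above (suc j +ℕ t) (s≤s (ℕP.m≤m+n j t))) ⟩
    suc j +ℕ t ∸ suc j +ℕ 1 +ℕ i ∸ 1
      ≡⟨ cong (λ z → z +ℕ 1 +ℕ i ∸ 1) (ℕP.m+n∸m≡n (suc j) t) ⟩
    t +ℕ 1 +ℕ i ∸ 1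
      ≡⟨ shifted-index t i ⟩
    t +ℕ i ∎
    where open ≡-Reasoning

  second-product : prodFromTo (maxBelow inA b) b (λ k → geom (gL A k +ℕ i ∸ 1)) ≈ geomProd i (suc r)
  second-product = begin
    prodFromTo (maxBelow inA b) b G'
      ≈⟨ ≈-reflexive (cong (λ z → prodFromTo z b G') (max-above b 1+j≤b)) ⟩
    prodFromTo (suc j) b G'
      ≈⟨ prodFromTo-range (suc j) b G' ⟩
    prodRange (suc j) (b ∸ j) G'
      ≈⟨ ≈-reflexive (cong (λ z → prodRange (suc j) z G') b∸j) ⟩
    prodRange (suc j) (suc r) G'
      ≈⟨ ≈-sym (geomProd-range i (suc j) (suc r) G' (λ t _ → cong geom (index-above t))) ⟩
    geomProd i (suc r) ∎
    where
    open ≈-Reasoning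
    G' : ℕ → PS
    G' k = geom (gL A k +ℕ i ∸ 1)
  summand-top : termL b i ls A ≈ scale (- + 1) (termL j 1 ls' as ⊛ Unbounded i (suc r) (suc (listAtN ls r)))
  summand-top = begin
    scale (negOnePow (countTrue A)) X
      ≈⟨ ≈-reflexive (cong (λ s → scale (negOnePow s) X) (countTrue-snoc-top as r)) ⟩
    scale (- s') X
      ≈⟨ (λ n → cong (_*ᶻ X n) (sym (ℤP.-1*i≡-i s'))) ⟩
    scale ((- + 1) *ᶻ s') X
      ≈⟨ ≈-sym (scale-scale (- + 1) s' X) ⟩
    scale (- + 1) (scale s' X)
      ≈⟨ scale-cong (- + 1) (scale-cong s' regroup) ⟩
    scale (- + 1) (scale s' ((monomial exponentA' ⊛ productsA') ⊛ U))
      ≈⟨ scale-cong (- + 1) (≈-sym (scale-⊛ˡ s' (monomial exponentA' ⊛ productsA') U)) ⟩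
    scale (- + 1) (termL j 1 ls' as ⊛ U) ∎
    where
    open ≈-Reasoning
    s' = negOnePow (countTrue as)
    U = Unbounded i (suc r) (suc (listAtN ls r))
    X = monomial exponentA ⊛ (prodFromTo 1 (maxBelow inA b ∸ 1) (λ k → geom (gL A k))
                            ⊛ prodFromTo (maxBelow inA b) b (λ k → geom (gL A k +ℕ i ∸ 1)))
    regroup : X ≈ (monomial exponentA' ⊛ productsA') ⊛ U
    regroup = begin
      X ≈⟨ ⊛-cong (monomial-cong exponent-split) (⊛-cong (≈-trans first-product (≈-sym products-A')) second-product) ⟩
      monomial (exponentA' +ℕ C *ℕ (r +ℕ i)) ⊛ (productsA' ⊛ geomProd i (suc r))
        ≈⟨ monomial-+-⊛ exponentA' (C *ℕ (r +ℕ i)) productsA' (geomProd i (suc r)) ⟩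
      (monomial exponentA' ⊛ productsA') ⊛ (monomial (C *ℕ (r +ℕ i)) ⊛ geomProd i (suc r))
        ≈⟨ ⊛-congʳ (monomial exponentA' ⊛ productsA')
             (⊛-congˡ (geomProd i (suc r)) (monomial-cong (cong (_*ℕ (r +ℕ i)) (ℕP.+-comm (listAtN ls r) 1)))) ⟩
      (monomial exponentA' ⊛ productsA') ⊛ U ∎

open LargestElement using (summand-top)

summand-empty : ∀ i b ls → termL b i ls (replicate b false) ≈ Unbounded i b 0
summand-empty i b ls = begin
  scale (negOnePow (countTrue Z)) X
    ≈⟨ ≈-reflexive (cong (λ s → scale (negOnePow s) X) (countTrue-replicate b)) ⟩
  scale (+ 1) X
    ≈⟨ scale-one X ⟩
  monomial exponent ⊛ (prodFromTo 1 (maxBelow inZ b ∸ 1) (λ k → geom (gL Z k)) ⊛ P₂)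
    ≈⟨ ⊛-cong (monomial-cong exponent≡0) (≈-trans
         (⊛-congˡ P₂ (≈-reflexive (cong (λ z → prodFromTo 1 (z ∸ 1) (λ k → geom (gL Z k))) (maxBelow-empty inZ b none))))
         (⊛-identityˡ P₂)) ⟩
  monomial 0 ⊛ P₂
    ≈⟨ ⊛-congʳ (monomial 0) second-product ⟩
  monomial 0 ⊛ geomProd i b ∎
  where
  open ≈-Reasoning
  Z = replicate b false
  inZ = memberL Z
  none : ∀ t → inZ t ≡ false
  none zero    = refl
  none (suc t) = listAtB-replicate b t
  exponent = sumNatFromTo 1 (b ∸ 1) (fL b ls Z) +ℕ i *ℕ fL b ls Z b
  P₂ = prodFromTo (maxBelow inZ b) b (λ k → geom (gL Z k +ℕ i ∸ 1))
  X = monomial exponent ⊛ (prodFromTo 1 (maxBelow inZ b ∸ 1) (λ k → geom (gL Z k)) ⊛ P₂)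
  f-zero : ∀ k → fL b ls Z k ≡ 0
  f-zero k rewrite meetsBelow-empty inZ k none = refl
  sumFrom1-zero : ∀ n → sumFrom1 n (λ _ → 0) ≡ 0
  sumFrom1-zero zero    = refl
  sumFrom1-zero (suc n) = trans (ℕP.+-identityʳ _) (sumFrom1-zero n)
  exponent≡0 : exponent ≡ 0
  exponent≡0 = cong₂ _+ℕ_
    (trans (sumNatFromTo-cong 1 (b ∸ 1) f-zero)
           (trans (sumNatFromTo-sumFrom1 (b ∸ 1) (λ _ → 0)) (sumFrom1-zero (b ∸ 1))))
    (trans (cong (i *ℕ_) (f-zero b)) (ℕP.*-zeroʳ i))
  second-product : P₂ ≈ geomProd i b
  second-product = begin
    P₂ ≈⟨ ≈-reflexive (cong (λ z → prodFromTo z b (λ k → geom (gL Z k +ℕ i ∸ 1))) (maxBelow-empty inZ b none)) ⟩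
    prodFromTo 1 b (λ k → geom (gL Z k +ℕ i ∸ 1))
      ≈⟨ prodFromTo-range 1 b (λ k → geom (gL Z k +ℕ i ∸ 1)) ⟩
    prodRange 1 b (λ k → geom (gL Z k +ℕ i ∸ 1))
      ≈⟨ ≈-sym (geomProd-range i 1 b (λ k → geom (gL Z k +ℕ i ∸ 1)) (λ t _ → cong geom
           (trans (cong (λ z → suc t ∸ z +ℕ 1 +ℕ i ∸ 1) (maxBelow-empty inZ (suc t) none)) (shifted-index t i)))) ⟩
    geomProd i b ∎

DecreasingL : List ℕ → Set
DecreasingL []           = ⊤
DecreasingL (x ∷ [])     = ⊤
DecreasingL (x ∷ y ∷ xs) = (y ≤ x) × DecreasingL (y ∷ xs)

Decreasing-toList : ∀ {n} (lam : Vec ℕ n) → Decreasing lam → DecreasingL (toList lam)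
Decreasing-toList Vec.[]                  _       = tt
Decreasing-toList (x Vec.∷ Vec.[])        _       = tt
Decreasing-toList (x Vec.∷ y Vec.∷ lam)   (p , d) = p , Decreasing-toList (y Vec.∷ lam) d

DecreasingL-tail : ∀ x xs → DecreasingL (x ∷ xs) → DecreasingL xs
DecreasingL-tail x []       _       = tt
DecreasingL-tail x (y ∷ xs) (_ , d) = d

DecreasingL-drop : ∀ d xs → DecreasingL xs → DecreasingL (drop d xs)
DecreasingL-drop zero    xs       p = p
DecreasingL-drop (suc d) []       p = tt
DecreasingL-drop (suc d) (x ∷ xs) p = DecreasingL-drop d xs (DecreasingL-tail x xs p)

DecreasingL-head : ∀ x xs → DecreasingL (x ∷ xs) → All (_≤ x) xs
DecreasingL-head x []       _       = []
DecreasingL-head x (y ∷ xs) (p , d) = p ∷ All.map (λ q → ℕP.≤-trans q p) (DecreasingL-head y xs d)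

All-reverse : ∀ {P : ℕ → Set} xs → All P xs → All P (reverse xs)
All-reverse []       _          = []
All-reverse (x ∷ xs) (px ∷ pxs) =
  subst (All _) (sym (ListP.unfold-reverse x xs)) (AllP.++⁺ (All-reverse xs pxs) (px ∷ []))

Increasing-snoc : ∀ L x → Increasing L → All (_≤ x) L → Increasing (L ++ x ∷ [])
Increasing-snoc []      x _           _          = [] , tt
Increasing-snoc (l ∷ L) x (l≤L , inc) (l≤x ∷ L≤x) = AllP.++⁺ l≤L (l≤x ∷ []) , Increasing-snoc L x inc L≤x

Increasing-reverse : ∀ ls → DecreasingL ls → Increasing (reverse ls)
Increasing-reverse []       _ = tt
Increasing-reverse (x ∷ xs) d = subst Increasing (sym (ListP.unfold-reverse x xs))
  (Increasing-snoc (reverse xs) x (Increasing-reverse xs (DecreasingL-tail x xs d))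
                   (All-reverse xs (DecreasingL-head x xs d)))

LowerFits-0 : ∀ L → LowerFits 0 L
LowerFits-0 []      = tt
LowerFits-0 (_ ∷ _) = z≤n

take-++-length : ∀ (xs ys : List ℕ) → take (length xs) (xs ++ ys) ≡ xs
take-++-length []       ys = refl
take-++-length (x ∷ xs) ys = cong (x ∷_) (take-++-length xs ys)

reverse-drop : ∀ ls j → j ≤ length ls → reverse (drop (length ls ∸ j) ls) ≡ take j (reverse ls)
reverse-drop ls j j≤ls = begin
  R                                          ≡⟨ sym (take-++-length R (reverse (take d ls))) ⟩
  take (length R) (R ++ reverse (take d ls)) ≡⟨ cong₂ take length-R (sym (ListP.reverse-++ (take d ls) (drop d ls))) ⟩
  take j (reverse (take d ls ++ drop d ls))  ≡⟨ cong (λ z → take j (reverse z)) (ListP.take++drop≡id d ls) ⟩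
  take j (reverse ls)                        ∎
  where
  open ≡-Reasoning
  d = length ls ∸ j
  R = reverse (drop d ls)
  length-R : length R ≡ j
  length-R = trans (ListP.length-reverse (drop d ls))
                   (trans (ListP.length-drop d ls) (ℕP.m∸[m∸n]≡n j≤ls))

ListIdentity : ℕ → List ℕ → Set
ListIdentity i ls = ∀ {b} → length ls ≡ b → ΣSub b (termL b i ls) ≈ Bounded i (reverse ls) 0

bounded-by-violations : ∀ i → 1 ≤ i → ∀ ls → DecreasingL ls →
  Bounded i (reverse ls) 0 ≈
    Unbounded i (length ls) 0 ⊕ scale (- + 1) (Σ< (length ls) (λ j →
      Bounded 1 (take j (reverse ls)) 0 ⊛ Unbounded i (length ls ∸ j) (suc (listAtN (reverse ls) j))))
bounded-by-violations i 1≤i ls d =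
  subst (λ m → Bounded i L 0 ≈ Unbounded i m 0 ⊕ scale (- + 1) (Σ< m (λ j →
           Bounded 1 (take j L) 0 ⊛ Unbounded i (m ∸ j) (suc (listAtN L j)))))
        (ListP.length-reverse ls)
        (≈-trans (⊕-solveˡ (unbounded-split i 1≤i L 0 (Increasing-reverse ls d) (LowerFits-0 L)))
                 (⊕-congʳ (Unbounded i (length L) 0) (scale-cong (- + 1) (violating-closed i L 0))))
  where L = reverse ls

summands-with-max : ∀ i ls j → DecreasingL ls → j < length ls →
  ListIdentity 1 (drop (length ls ∸ j) ls) →
  ΣSub j (λ as → termL (length ls) i ls (as ++ true ∷ replicate (length ls ∸ suc j) false ++ [])) ≈
    scale (- + 1) (Bounded 1 (take j (reverse ls)) 0
                   ⊛ Unbounded i (length ls ∸ j) (suc (listAtN (reverse ls) j)))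
summands-with-max i ls j d j<b ih = begin
  ΣSub j (λ as → termL b i ls (as ++ true ∷ replicate r false ++ []))
    ≈⟨ ΣSub-cong j (λ as |as| → ≈-trans
         (≈-reflexive (cong₂ (λ b' tail → termL b' i ls (as ++ true ∷ tail)) (b-split as |as|)
                             (ListP.++-identityʳ (replicate r false))))
         (≈-trans (summand-top i as r ls)
                  (≈-reflexive (cong (λ m → scale (- + 1) (termL m 1 (drop (suc r) ls) as ⊛ U)) |as|)))) ⟩
  ΣSub j (λ as → scale (- + 1) (termL j 1 (drop (suc r) ls) as ⊛ U))
    ≈⟨ ΣSub-scale-⊛ j (- + 1) (termL j 1 (drop (suc r) ls)) U ⟩
  scale (- + 1) (ΣSub j (termL j 1 (drop (suc r) ls)) ⊛ U)
    ≈⟨ scale-cong (- + 1) (⊛-cong (≈-trans (ih' length-tail) bounds) above) ⟩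
  scale (- + 1) (Bounded 1 (take j (reverse ls)) 0 ⊛ Unbounded i (b ∸ j) (suc (listAtN (reverse ls) j))) ∎
  where
  open ≈-Reasoning
  b = length ls
  r = b ∸ suc j
  U = Unbounded i (suc r) (suc (listAtN ls r))
  1+r≡b∸j : suc r ≡ b ∸ j
  1+r≡b∸j = sym (ℕP.+-∸-assoc 1 j<b)
  b-split : ∀ as → length as ≡ j → b ≡ length as +ℕ suc r
  b-split as refl = sym (trans (cong (j +ℕ_) 1+r≡b∸j) (ℕP.m+[n∸m]≡n (ℕP.<⇒≤ j<b)))
  ih' : length (drop (suc r) ls) ≡ j → ΣSub j (termL j 1 (drop (suc r) ls)) ≈ Bounded 1 (reverse (drop (suc r) ls)) 0
  ih' rewrite 1+r≡b∸j = ih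
  length-tail : length (drop (suc r) ls) ≡ j
  length-tail = trans (ListP.length-drop (suc r) ls) (trans (cong (b ∸_) 1+r≡b∸j) (ℕP.m∸[m∸n]≡n (ℕP.<⇒≤ j<b)))
  bounds : Bounded 1 (reverse (drop (suc r) ls)) 0 ≈ Bounded 1 (take j (reverse ls)) 0
  bounds = ≈-reflexive (cong (λ L → Bounded 1 L 0)
             (trans (cong (λ z → reverse (drop z ls)) 1+r≡b∸j) (reverse-drop ls j (ℕP.<⇒≤ j<b))))
  above : U ≈ Unbounded i (b ∸ j) (suc (listAtN (reverse ls) j))
  above = ≈-reflexive (cong₂ (λ m x → Unbounded i m (suc x)) 1+r≡b∸j (sym (listAtN-reverse ls j j<b)))

-- inclusion–exclusion over the largest element of A, assuming the theorem for shorter partitions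
list-identity-step : ∀ ls i → 1 ≤ i → DecreasingL ls →
  (∀ ls' → length ls' < length ls → DecreasingL ls' → ListIdentity 1 ls') → ListIdentity i ls
list-identity-step ls i 1≤i d shorter refl = begin
  ΣSub b (termL b i ls)
    ≈⟨ ΣSub-cong b (λ as _ → ≈-reflexive (cong (termL b i ls) (sym (ListP.++-identityʳ as)))) ⟩
  ΣSub b (λ as → termL b i ls (as ++ []))
    ≈⟨ ΣSub-byMax b [] (termL b i ls) ⟩
  termL b i ls (replicate b false ++ [])
    ⊕ Σ< b (λ j → ΣSub j (λ as → termL b i ls (as ++ true ∷ replicate (b ∸ suc j) false ++ [])))
    ≈⟨ ⊕-cong (≈-trans (≈-reflexive (cong (termL b i ls) (ListP.++-identityʳ (replicate b false))))
                       (summand-empty i b ls))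
              (Σ<-cong b (λ j j<b → summands-with-max i ls j d j<b
                 (shorter (drop (b ∸ j) ls) (drop-shorter j j<b) (DecreasingL-drop (b ∸ j) ls d)))) ⟩
  Unbounded i b 0 ⊕ Σ< b (λ j → scale (- + 1) (Fj j))
    ≈⟨ ⊕-congʳ (Unbounded i b 0) (Σ<-scale b (- + 1) Fj) ⟩
  Unbounded i b 0 ⊕ scale (- + 1) (Σ< b Fj)
    ≈⟨ ≈-sym (bounded-by-violations i 1≤i ls d) ⟩
  Bounded i (reverse ls) 0 ∎
  where
  open ≈-Reasoning
  b = length ls
  Fj : ℕ → PS
  Fj j = Bounded 1 (take j (reverse ls)) 0 ⊛ Unbounded i (b ∸ j) (suc (listAtN (reverse ls) j))
  drop-shorter : ∀ j → j < b → length (drop (b ∸ j) ls) < b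
  drop-shorter j j<b = subst (_< b) (sym (trans (ListP.length-drop (b ∸ j) ls) (ℕP.m∸[m∸n]≡n (ℕP.<⇒≤ j<b)))) j<b

list-identity : ∀ N ls → length ls ≤ N → ∀ i → 1 ≤ i → DecreasingL ls → ListIdentity i ls
list-identity zero    ls ls≤0 i 1≤i d = list-identity-step ls i 1≤i d
  (λ ls' ls'<ls _ → ⊥-elim (ℕP.<⇒≱ (ℕP.<-≤-trans ls'<ls ls≤0) z≤n))
list-identity (suc N) ls ls≤N i 1≤i d = list-identity-step ls i 1≤i d
  (λ ls' ls'<ls d' → list-identity N ls' (ℕP.≤-pred (ℕP.<-≤-trans ls'<ls ls≤N)) 1 ℕP.≤-refl d')

mainTheorem4 : (b : ℕ) → 1 ≤ b → (lam : Vec ℕ b) → Decreasing lam → Positive lam →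
  (i : ℕ) → 1 ≤ i → (n : ℕ) → G i lam n ≡ RHS i lam n
mainTheorem4 b _ lam dec _ i 1≤i = begin
  G i lam                                   ≈⟨ G≈Bounded i lam ⟩
  Bounded i (reverse (toList lam)) 0        ≈⟨ ≈-sym (list-identity b (toList lam) (ℕP.≤-reflexive (VecP.length-toList lam))
                                                        i 1≤i (Decreasing-toList lam dec) (VecP.length-toList lam)) ⟩
  ΣSub b (termL b i (toList lam))           ≈⟨ ≈-sym (RHS≈ΣSub i lam) ⟩
  RHS i lam                                 ∎
  where open ≈-Reasoning
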